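{- Let $G$ be a connected simple graph. The following are equivalent: (1) the Smith normal form of $A(G)$ has at most 3 invariant factors equal to 1; (2) $G$ contains none of $P_4$, the paw, and $K_5$ as an induced subgraph; (3) $G$ is an induced subgraph of a complete four-partite graph.
   Context: $A(G)$ is the adjacency matrix of $G$; the Smith normal form is taken over $\mathbb{Z}$. $P_4$ is the path on 4 vertices and the paw is a triangle with one pendant vertex attached. -}

module Defs where

open import Data.Nat as ℕ using (ℕ; zero; suc; _≤_)
open import Data.Fin using (Fin; zero; suc; toℕ)
open import Data.Bool using (Bool; true; false; if_then_else_)
open import Data.Integer as ℤ using (ℤ; +_; 0ℤ; 1ℤ)
open import Data.Integer.Divisibility as ℤD using ()
open import Data.Product using (Σ; ∃; _×_; _,_)
open import Relation.Binary.PropositionalEquality using (_≡_; _≢_)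
open import Relation.Nullary using (yes; no)
open import Function.Definitions using (Injective; Surjective)

Adj : ℕ → Set
Adj n = Fin n → Fin n → Bool

record IsSimple {n : ℕ} (G : Adj n) : Set where
  field
    symmetric : ∀ i j → G i j ≡ G j i
    loopless  : ∀ i → G i i ≡ false

data Reach {n : ℕ} (G : Adj n) : Fin n → Fin n → Set where
  here : ∀ {i} → Reach G i i
  step : ∀ {i k j} → G i k ≡ true → Reach G k j → Reach G i j

Connected : {n : ℕ} → Adj n → Set
Connected {n} G = ∀ (i j : Fin n) → Reach G i j

IsInducedSubgraph : {m n : ℕ} → Adj m → Adj n → Set
IsInducedSubgraph {m} {n} H G =
  Σ (Fin m → Fin n) λ f → Injective _≡_ _≡_ f × (∀ i j → H i j ≡ G (f i) (f j))

P₄ : Adj 4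
P₄ zero (suc zero) = true
P₄ (suc zero) zero = true
P₄ (suc zero) (suc (suc zero)) = true
P₄ (suc (suc zero)) (suc zero) = true
P₄ (suc (suc zero)) (suc (suc (suc zero))) = true
P₄ (suc (suc (suc zero))) (suc (suc zero)) = true
P₄ _ _ = false

-- paw : triangle 0 1 2 with pendant vertex 3 attached to 2
paw : Adj 4
paw zero (suc zero) = true
paw (suc zero) zero = true
paw zero (suc (suc zero)) = true
paw (suc (suc zero)) zero = true
paw (suc zero) (suc (suc zero)) = true
paw (suc (suc zero)) (suc zero) = true
paw (suc (suc zero)) (suc (suc (suc zero))) = true
paw (suc (suc (suc zero))) (suc (suc zero)) = true
paw _ _ = false

complete : (n : ℕ) → Adj n
complete n i j with i Data.Fin.≟ j
... | yes _ = false
... | no  _ = true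

K₅ : Adj 5
K₅ = complete 5

completeMultipartite : {N k : ℕ} → (Fin N → Fin k) → Adj N
completeMultipartite p i j with p i Data.Fin.≟ p j
... | yes _ = false
... | no  _ = true

-- complete four-partite graph: all four parts nonempty (p surjective)
IsInducedSubgraphOfComplete4Partite : {n : ℕ} → Adj n → Set
IsInducedSubgraphOfComplete4Partite G =
  Σ ℕ λ N → Σ (Fin N → Fin 4) λ p →
    Surjective _≡_ _≡_ p × IsInducedSubgraph G (completeMultipartite p)

Mat : ℕ → Set
Mat n = Fin n → Fin n → ℤ

sumFin : {n : ℕ} → (Fin n → ℤ) → ℤ
sumFin {zero}  f = 0ℤ
sumFin {suc n} f = f zero ℤ.+ sumFin (λ i → f (suc i))

_⊗_ : {n : ℕ} → Mat n → Mat n → Mat n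
(A ⊗ B) i j = sumFin (λ k → A i k ℤ.* B k j)

idMat : {n : ℕ} → Mat n
idMat i j with i Data.Fin.≟ j
... | yes _ = 1ℤ
... | no  _ = 0ℤ

_≈M_ : {n : ℕ} → Mat n → Mat n → Set
A ≈M B = ∀ i j → A i j ≡ B i j

Unimodular : {n : ℕ} → Mat n → Set
Unimodular {n} P = Σ (Mat n) λ P' → ((P ⊗ P') ≈M idMat) × ((P' ⊗ P) ≈M idMat)

-- D is in Smith normal form: diagonal, nonnegative diagonal entries,
-- d_i ∣ d_j whenever i ≤ j (so zero entries come last)
IsSmithForm : {n : ℕ} → Mat n → Set
IsSmithForm {n} D =
  (∀ i j → i ≢ j → D i j ≡ 0ℤ) ×
  (∀ i → 0ℤ ℤ.≤ D i i) ×
  (∀ i j → toℕ i ≤ toℕ j → D i i ℤD.∣ D j j)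

IsSNFOf : {n : ℕ} → Mat n → Mat n → Set
IsSNFOf {n} D A =
  IsSmithForm D × Σ (Mat n) λ P → Σ (Mat n) λ Q →
    Unimodular P × Unimodular Q × (((P ⊗ A) ⊗ Q) ≈M D)

countOnes : {n : ℕ} → Mat n → ℕ
countOnes {zero}  D = zero
countOnes {suc n} D with D zero zero ℤ.≟ 1ℤ
... | yes _ = suc (countOnes (λ i j → D (suc i) (suc j)))
... | no  _ = countOnes (λ i j → D (suc i) (suc j))

adjMat : {n : ℕ} → Adj n → Mat n
adjMat G i j = if G i j then 1ℤ else 0ℤ

-- (2) ⇔ (3). In a connected {P₄, paw}-free graph every edge dominates: a walk leaving the
-- closed neighbourhood of an edge yields an induced P₄ or paw. Hence non-adjacency is an
-- equivalence relation, G is complete multipartite, and K₅-freeness leaves at most four parts.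
-- Conversely non-adjacency is transitive in a blow-up of K₄, which excludes P₄ and the paw, and
-- the pigeonhole principle excludes K₅.
--
-- (1) ⇔ (2). Let D = PAQ be a Smith form with fourth invariant factor d₄. Modulo d₄ the matrix A
-- factors through rank 3, while I₄ factors through rank 3 modulo m only if m ∣ 1 (a cofactor
-- argument). The adjacency matrices of P₄, the paw and K₅ have unimodular 4 × 4 submatrices, so an
-- induced copy of one of them forces d₄ = 1, i.e. four invariant factors equal to 1. If instead G
-- is a blow-up of K₄, then A is a pullback of J₄ − I₄, which factors through rank 3 modulo 3, and
-- d₄ = 1 would make the leading 4 × 4 block of PAQ the identity.

module Submission where

open import Defs
open import Data.Nat using (ℕ; _≤_)
open import Data.Product using (_×_)
open import Relation.Nullary using (¬_)
open import Function.Bundles using (_⇔_; mk⇔; Equivalence)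
import Function.Properties.Equivalence as ⇔
open import Data.Nat as ℕ using (zero; suc; z≤n; s≤s)
import Data.Nat.Properties as ℕP
import Data.Nat.Divisibility as ℕD
open import Data.Fin using (Fin; zero; suc; toℕ)
open import Data.Fin.Patterns using (0F; 1F; 2F; 3F; 4F)
import Data.Fin as F
import Data.Fin.Properties as FP
open import Data.Fin.Permutation using (Permutation′; _⟨$⟩ʳ_; _⟨$⟩ˡ_; inverseˡ; inverseʳ; flip; transpose)
open import Data.Integer using (ℤ; +_; -[1+_]; _+_; _*_; -_; _-_; 0ℤ; 1ℤ; -1ℤ; ∣_∣)
import Data.Integer as ℤ
import Data.Integer.Properties as ℤP
import Data.Integer.Divisibility as ℤD
open import Data.Integer.Divisibility.Signed
  using (_∣_; _∣?_; divides; ∣⇒∣ᵤ; ∣ᵤ⇒∣; ∣-trans; ∣m∣∣m; ∣m∣n⇒∣m+n; ∣m⇒∣-m; ∣n⇒∣m*n; ∣m⇒∣m*n)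
open import Data.Integer.DivMod using (a≡a%n+[a/n]*n; n%d<d)
open import Data.Integer.Base using (≢-nonZero; _/_; _%_)
open import Data.Integer.Tactic.RingSolver using (solve-∀)
open import Algebra.Properties.Semiring.Sum ℤP.+-*-semiring
  using (sum; ∑-distrib-+; ∑-comm; *-distribˡ-sum)
open import Data.Bool using (Bool; true; false; if_then_else_)
import Data.Bool.Properties as BoolP
open import Data.Vec using (Vec; []; _∷_; lookup)
open import Data.Product using (Σ; ∃; ∃₂; _,_; proj₁; proj₂)
open import Data.Sum using (_⊎_; inj₁; inj₂)
open import Data.Empty using (⊥-elim)
open import Function using (_∘_)
open import Function.Definitions using (Injective; Surjective)
open import Relation.Binary.PropositionalEquality
open import Relation.Nullary using (yes; no; Dec; contradiction)
open import Relation.Nullary.Decidable using (from-yes; _×-dec_; _→-dec_)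
import Relation.Nullary.Decidable as Dec
open import Relation.Unary using (Pred; Decidable)
open import Relation.Binary.Bundles using (Setoid)
import Relation.Binary.Reasoning.Setoid as SetoidReasoning
open import Relation.Binary.Structures using (IsDecEquivalence)

-- Finite sums

sum-cong : ∀ {n} {f g : Fin n → ℤ} → (∀ i → f i ≡ g i) → sumFin f ≡ sumFin g
sum-cong {zero}  e = refl
sum-cong {suc n} e = cong₂ _+_ (e zero) (sum-cong (e ∘ suc))

sum-zero : ∀ {n} {f : Fin n → ℤ} → (∀ i → f i ≡ 0ℤ) → sumFin f ≡ 0ℤ
sum-zero {zero}  e = refl
sum-zero {suc n} e = cong₂ _+_ (e zero) (sum-zero (e ∘ suc))

sumFin≗sum : ∀ {n} (f : Fin n → ℤ) → sumFin f ≡ sum f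
sumFin≗sum {zero}  f = refl
sumFin≗sum {suc n} f = cong (_+_ (f zero)) (sumFin≗sum (f ∘ suc))

sum-+ : ∀ {n} (f g : Fin n → ℤ) → sumFin (λ i → f i + g i) ≡ sumFin f + sumFin g
sum-+ f g = begin
  sumFin (λ i → f i + g i) ≡⟨ sumFin≗sum (λ i → f i + g i) ⟩
  sum (λ i → f i + g i)    ≡⟨ ∑-distrib-+ f g ⟩
  sum f + sum g            ≡⟨ sym (cong₂ _+_ (sumFin≗sum f) (sumFin≗sum g)) ⟩
  sumFin f + sumFin g      ∎
  where open ≡-Reasoning

sum-*ˡ : ∀ {n} c (f : Fin n → ℤ) → sumFin (λ i → c * f i) ≡ c * sumFin f
sum-*ˡ c f = begin
  sumFin (λ i → c * f i) ≡⟨ sumFin≗sum (λ i → c * f i) ⟩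
  sum (λ i → c * f i)    ≡⟨ sym (*-distribˡ-sum c f) ⟩
  c * sum f              ≡⟨ cong (c *_) (sym (sumFin≗sum f)) ⟩
  c * sumFin f           ∎
  where open ≡-Reasoning

sum-*ʳ : ∀ {n} c (f : Fin n → ℤ) → sumFin (λ i → f i * c) ≡ sumFin f * c
sum-*ʳ c f = trans (sum-cong (λ i → ℤP.*-comm (f i) c)) (trans (sum-*ˡ c f) (ℤP.*-comm c _))

sum-swap : ∀ {m n} (f : Fin m → Fin n → ℤ) →
  sumFin (λ i → sumFin (f i)) ≡ sumFin (λ j → sumFin (λ i → f i j))
sum-swap f = begin
  sumFin (λ i → sumFin (f i))          ≡⟨ sum-cong (λ i → sumFin≗sum (f i)) ⟩
  sumFin (λ i → sum (f i))             ≡⟨ sumFin≗sum (λ i → sum (f i)) ⟩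
  sum (λ i → sum (f i))                ≡⟨ ∑-comm f ⟩
  sum (λ j → sum (λ i → f i j))        ≡⟨ sym (sumFin≗sum (λ j → sum (λ i → f i j))) ⟩
  sumFin (λ j → sum (λ i → f i j))     ≡⟨ sym (sum-cong (λ j → sumFin≗sum (λ i → f i j))) ⟩
  sumFin (λ j → sumFin (λ i → f i j))  ∎
  where open ≡-Reasoning

sum-supportedAt : ∀ {n} (k : Fin n) (f : Fin n → ℤ) → (∀ i → i ≢ k → f i ≡ 0ℤ) → sumFin f ≡ f k
sum-supportedAt zero f z =
  trans (cong (_+_ (f zero)) (sum-zero (λ i → z (suc i) (λ ())))) (ℤP.+-identityʳ _)
sum-supportedAt (suc k) f z =
  trans (cong₂ _+_ (z zero (λ ())) (sum-supportedAt k (f ∘ suc) (λ i i≢k → z (suc i) (i≢k ∘ FP.suc-injective))))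
        (ℤP.+-identityˡ _)

-- Matrices and their equivalence

Matrix : ℕ → ℕ → Set
Matrix m n = Fin m → Fin n → ℤ

infixl 7 _·_
-- On square matrices _·_ agrees definitionally with _⊗_.
_·_ : ∀ {m n p} → Matrix m n → Matrix n p → Matrix m p
(A · B) i j = sumFin (λ k → A i k * B k j)

idMat-diag : ∀ {n} (i : Fin n) → idMat i i ≡ 1ℤ
idMat-diag i with i F.≟ i
... | yes _  = refl
... | no i≢i = ⊥-elim (i≢i refl)

idMat-off : ∀ {n} {i j : Fin n} → i ≢ j → idMat i j ≡ 0ℤ
idMat-off {i = i} {j} i≢j with i F.≟ j
... | yes i≡j = ⊥-elim (i≢j i≡j)
... | no _    = refl

idMat-suc : ∀ {n} (i j : Fin n) → idMat (suc i) (suc j) ≡ idMat i j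
idMat-suc i j = by-cases (i F.≟ j)
  where
  by-cases : Dec (i ≡ j) → idMat (suc i) (suc j) ≡ idMat i j
  by-cases (yes refl) = trans (idMat-diag (suc i)) (sym (idMat-diag i))
  by-cases (no i≢j)   = trans (idMat-off (i≢j ∘ FP.suc-injective)) (sym (idMat-off i≢j))

sum-idMatˡ : ∀ {n} (i : Fin n) (f : Fin n → ℤ) → sumFin (λ k → idMat i k * f k) ≡ f i
sum-idMatˡ i f = begin
  sumFin (λ k → idMat i k * f k) ≡⟨ sum-supportedAt i _ (λ k k≢i → cong (_* f k) (idMat-off (k≢i ∘ sym))) ⟩
  idMat i i * f i                ≡⟨ cong (_* f i) (idMat-diag i) ⟩
  1ℤ * f i                       ≡⟨ ℤP.*-identityˡ (f i) ⟩
  f i                            ∎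
  where open ≡-Reasoning

sum-idMatʳ : ∀ {n} (j : Fin n) (f : Fin n → ℤ) → sumFin (λ k → f k * idMat k j) ≡ f j
sum-idMatʳ j f = begin
  sumFin (λ k → f k * idMat k j) ≡⟨ sum-supportedAt j _ (λ k k≢j → trans (cong (f k *_) (idMat-off k≢j)) (ℤP.*-zeroʳ (f k))) ⟩
  f j * idMat j j                ≡⟨ cong (f j *_) (idMat-diag j) ⟩
  f j * 1ℤ                       ≡⟨ ℤP.*-identityʳ (f j) ⟩
  f j                            ∎
  where open ≡-Reasoning

·-identityˡ : ∀ {m n} (A : Matrix m n) i j → (idMat · A) i j ≡ A i j
·-identityˡ A i j = sum-idMatˡ i (λ k → A k j)

·-identityʳ : ∀ {m n} (A : Matrix m n) i j → (A · idMat) i j ≡ A i j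
·-identityʳ A i j = sum-idMatʳ j (A i)

·-assoc : ∀ {m n p q} (A : Matrix m n) (B : Matrix n p) (C : Matrix p q) i j →
  ((A · B) · C) i j ≡ (A · (B · C)) i j
·-assoc A B C i j = begin
  sumFin (λ k → sumFin (λ l → A i l * B l k) * C k j)   ≡⟨ sum-cong (λ k → sym (sum-*ʳ (C k j) (λ l → A i l * B l k))) ⟩
  sumFin (λ k → sumFin (λ l → A i l * B l k * C k j))   ≡⟨ sum-swap (λ k l → A i l * B l k * C k j) ⟩
  sumFin (λ l → sumFin (λ k → A i l * B l k * C k j))   ≡⟨ sum-cong (λ l → sum-cong (λ k → ℤP.*-assoc (A i l) (B l k) (C k j))) ⟩
  sumFin (λ l → sumFin (λ k → A i l * (B l k * C k j))) ≡⟨ sum-cong (λ l → sum-*ˡ (A i l) (λ k → B l k * C k j)) ⟩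
  sumFin (λ l → A i l * sumFin (λ k → B l k * C k j))   ∎
  where open ≡-Reasoning

·-congˡ : ∀ {m n p} {A A' : Matrix m n} (B : Matrix n p) →
  (∀ i k → A i k ≡ A' i k) → ∀ i j → (A · B) i j ≡ (A' · B) i j
·-congˡ B e i j = sum-cong (λ k → cong (_* B k j) (e i k))

·-congʳ : ∀ {m n p} (A : Matrix m n) {B B' : Matrix n p} →
  (∀ k j → B k j ≡ B' k j) → ∀ i j → (A · B) i j ≡ (A · B') i j
·-congʳ A e i j = sum-cong (λ k → cong (A i k *_) (e k j))

≈M-sym : ∀ {n} {A B : Mat n} → A ≈M B → B ≈M A
≈M-sym e i j = sym (e i j)

≈M-setoid : ℕ → Setoid _ _
≈M-setoid n = record
  { Carrier       = Mat n
  ; _≈_           = _≈M_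
  ; isEquivalence = record
    { refl  = λ i j → refl
    ; sym   = ≈M-sym
    ; trans = λ e f i j → trans (e i j) (f i j)
    }
  }

module MatReasoning {n : ℕ} = SetoidReasoning (≈M-setoid n)

idMat-unimodular : ∀ {n} → Unimodular {n} idMat
idMat-unimodular = idMat , ·-identityˡ idMat , ·-identityˡ idMat

⊗-unimodular : ∀ {n} {P Q : Mat n} → Unimodular P → Unimodular Q → Unimodular (P ⊗ Q)
⊗-unimodular {n} {P} {Q} (P⁻¹ , PP⁻¹ , P⁻¹P) (Q⁻¹ , QQ⁻¹ , Q⁻¹Q) = Q⁻¹ ⊗ P⁻¹ , right , left
  where
  open MatReasoning
  right : ((P ⊗ Q) ⊗ (Q⁻¹ ⊗ P⁻¹)) ≈M idMat
  right = begin
    (P ⊗ Q) ⊗ (Q⁻¹ ⊗ P⁻¹)   ≈⟨ ·-assoc P Q _ ⟩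
    P ⊗ (Q ⊗ (Q⁻¹ ⊗ P⁻¹))   ≈⟨ ·-congʳ P (≈M-sym (·-assoc Q Q⁻¹ P⁻¹)) ⟩
    P ⊗ ((Q ⊗ Q⁻¹) ⊗ P⁻¹)   ≈⟨ ·-congʳ P (·-congˡ P⁻¹ QQ⁻¹) ⟩
    P ⊗ (idMat ⊗ P⁻¹)       ≈⟨ ·-congʳ P (·-identityˡ P⁻¹) ⟩
    P ⊗ P⁻¹                 ≈⟨ PP⁻¹ ⟩
    idMat                   ∎
  left : ((Q⁻¹ ⊗ P⁻¹) ⊗ (P ⊗ Q)) ≈M idMat
  left = begin
    (Q⁻¹ ⊗ P⁻¹) ⊗ (P ⊗ Q)   ≈⟨ ·-assoc Q⁻¹ P⁻¹ _ ⟩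
    Q⁻¹ ⊗ (P⁻¹ ⊗ (P ⊗ Q))   ≈⟨ ·-congʳ Q⁻¹ (≈M-sym (·-assoc P⁻¹ P Q)) ⟩
    Q⁻¹ ⊗ ((P⁻¹ ⊗ P) ⊗ Q)   ≈⟨ ·-congʳ Q⁻¹ (·-congˡ Q P⁻¹P) ⟩
    Q⁻¹ ⊗ (idMat ⊗ Q)       ≈⟨ ·-congʳ Q⁻¹ (·-identityˡ Q) ⟩
    Q⁻¹ ⊗ Q                 ≈⟨ Q⁻¹Q ⟩
    idMat                   ∎

infix 4 _∼_
record _∼_ {n} (A B : Mat n) : Set where
  constructor equivalent
  field
    P Q       : Mat n
    P-unimod  : Unimodular P
    Q-unimod  : Unimodular Q
    PAQ≈B     : ((P ⊗ A) ⊗ Q) ≈M B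

∼-refl : ∀ {n} {A : Mat n} → A ∼ A
∼-refl {A = A} = equivalent idMat idMat idMat-unimodular idMat-unimodular
  (λ i j → trans (·-identityʳ (idMat ⊗ A) i j) (·-identityˡ A i j))

∼-resp-≈M : ∀ {n} {A B C : Mat n} → A ∼ B → B ≈M C → A ∼ C
∼-resp-≈M (equivalent P Q uP uQ e) f = equivalent P Q uP uQ (λ i j → trans (e i j) (f i j))

∼-trans : ∀ {n} {A B C : Mat n} → A ∼ B → B ∼ C → A ∼ C
∼-trans {A = A} {B} {C} (equivalent P Q uP uQ e) (equivalent P' Q' uP' uQ' e') =
  equivalent (P' ⊗ P) (Q ⊗ Q') (⊗-unimodular uP' uP) (⊗-unimodular uQ uQ') chain
  where
  open MatReasoning
  chain : (((P' ⊗ P) ⊗ A) ⊗ (Q ⊗ Q')) ≈M C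
  chain = begin
    ((P' ⊗ P) ⊗ A) ⊗ (Q ⊗ Q')   ≈⟨ ≈M-sym (·-assoc ((P' ⊗ P) ⊗ A) Q Q') ⟩
    (((P' ⊗ P) ⊗ A) ⊗ Q) ⊗ Q'   ≈⟨ ·-congˡ Q' (·-congˡ Q (·-assoc P' P A)) ⟩
    ((P' ⊗ (P ⊗ A)) ⊗ Q) ⊗ Q'   ≈⟨ ·-congˡ Q' (·-assoc P' (P ⊗ A) Q) ⟩
    (P' ⊗ ((P ⊗ A) ⊗ Q)) ⊗ Q'   ≈⟨ ·-congˡ Q' (·-congʳ P' e) ⟩
    (P' ⊗ B) ⊗ Q'               ≈⟨ e' ⟩
    C                           ∎

∼-⊗ˡ : ∀ {n} {A : Mat n} P → Unimodular P → A ∼ (P ⊗ A)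
∼-⊗ˡ {A = A} P uP = equivalent P idMat uP idMat-unimodular (·-identityʳ (P ⊗ A))

∼-⊗ʳ : ∀ {n} {A : Mat n} Q → Unimodular Q → A ∼ (A ⊗ Q)
∼-⊗ʳ {A = A} Q uQ = equivalent idMat Q idMat-unimodular uQ (·-congˡ Q (·-identityˡ A))

IsSNFOf⇔ : ∀ {n} {D A : Mat n} → IsSNFOf D A ⇔ (IsSmithForm D × A ∼ D)
IsSNFOf⇔ = mk⇔ (λ (smith , P , Q , uP , uQ , PAQ≈D) → smith , equivalent P Q uP uQ PAQ≈D)
               (λ (smith , equivalent P Q uP uQ PAQ≈D) → smith , P , Q , uP , uQ , PAQ≈D)

-- Congruences modulo an integer

infix 4 _≡_mod_
record _≡_mod_ (a b m : ℤ) : Set where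
  constructor mod-by
  field divides-difference : m ∣ a - b
open _≡_mod_

private
  ∣0 : ∀ m → m ∣ 0ℤ
  ∣0 m = divides 0ℤ (sym (ℤP.*-zeroˡ m))

  ∣-resp-≡ : ∀ {m a b} → a ≡ b → m ∣ a → m ∣ b
  ∣-resp-≡ refl m∣a = m∣a

≡mod-reflexive : ∀ {m a b} → a ≡ b → a ≡ b mod m
≡mod-reflexive {m} {a} refl = mod-by (∣-resp-≡ (sym (ℤP.+-inverseʳ a)) (∣0 m))

≡mod-refl : ∀ {m} a → a ≡ a mod m
≡mod-refl a = ≡mod-reflexive refl

≡mod-sym : ∀ {m a b} → a ≡ b mod m → b ≡ a mod m
≡mod-sym {a = a} {b} (mod-by d) = mod-by (∣-resp-≡ (negate-difference a b) (∣m⇒∣-m d))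
  where
  negate-difference : ∀ a b → - (a - b) ≡ b - a
  negate-difference = solve-∀

≡mod-trans : ∀ {m a b c} → a ≡ b mod m → b ≡ c mod m → a ≡ c mod m
≡mod-trans {a = a} {b} {c} (mod-by d) (mod-by e) = mod-by (∣-resp-≡ (telescope a b c) (∣m∣n⇒∣m+n d e))
  where
  telescope : ∀ a b c → (a - b) + (b - c) ≡ a - c
  telescope = solve-∀

infix 4 _≡?_mod_
_≡?_mod_ : ∀ a b m → Dec (a ≡ b mod m)
a ≡? b mod m = Dec.map′ mod-by divides-difference (m ∣? a - b)

mod-setoid : ℤ → Setoid _ _
mod-setoid m = record
  { Carrier       = ℤ
  ; _≈_           = λ a b → a ≡ b mod m
  ; isEquivalence = record { refl = ≡mod-refl _ ; sym = ≡mod-sym ; trans = ≡mod-trans }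
  }

module ModReasoning (m : ℤ) = SetoidReasoning (mod-setoid m)

≡mod-+ : ∀ {m a b c d} → a ≡ c mod m → b ≡ d mod m → a + b ≡ c + d mod m
≡mod-+ {a = a} {b} {c} {d} (mod-by x) (mod-by y) = mod-by (∣-resp-≡ (regroup a b c d) (∣m∣n⇒∣m+n x y))
  where
  regroup : ∀ a b c d → (a - c) + (b - d) ≡ (a + b) - (c + d)
  regroup = solve-∀

≡mod-* : ∀ {m a b c d} → a ≡ c mod m → b ≡ d mod m → a * b ≡ c * d mod m
≡mod-* {a = a} {b} {c} {d} (mod-by x) (mod-by y) =
  mod-by (∣-resp-≡ (regroup a b c d) (∣m∣n⇒∣m+n (∣n⇒∣m*n a y) (∣m⇒∣m*n d x)))
  where
  regroup : ∀ a b c d → a * (b - d) + (a - c) * d ≡ a * b - c * d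
  regroup = solve-∀

≡mod-neg : ∀ {m a c} → a ≡ c mod m → - a ≡ - c mod m
≡mod-neg {a = a} {c} (mod-by x) = mod-by (∣-resp-≡ (regroup a c) (∣m⇒∣-m x))
  where
  regroup : ∀ a c → - (a - c) ≡ (- a) - (- c)
  regroup = solve-∀

≡mod-0⇔∣ : ∀ {m a} → a ≡ 0ℤ mod m ⇔ m ∣ a
≡mod-0⇔∣ {a = a} = mk⇔ (∣-resp-≡ (ℤP.+-identityʳ a) ∘ divides-difference)
                        (mod-by ∘ ∣-resp-≡ (sym (ℤP.+-identityʳ a)))

sum-cong-mod : ∀ {m n} {f g : Fin n → ℤ} → (∀ i → f i ≡ g i mod m) → sumFin f ≡ sumFin g mod m
sum-cong-mod {n = zero}  e = ≡mod-refl 0ℤ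
sum-cong-mod {n = suc n} e = ≡mod-+ (e zero) (sum-cong-mod (e ∘ suc))

·-cong-mod : ∀ {m k n p q} (L : Matrix k n) {A A' : Matrix n p} (R : Matrix p q) →
  (∀ i j → A i j ≡ A' i j mod m) → ∀ i j → ((L · A) · R) i j ≡ ((L · A') · R) i j mod m
·-cong-mod L R e i j =
  sum-cong-mod (λ k → ≡mod-* (sum-cong-mod (λ l → ≡mod-* (≡mod-refl (L i l)) (e l k))) (≡mod-refl (R k j)))

-- Factorisations through rank 3

det₃ : Matrix 3 3 → ℤ
det₃ M = M 0F 0F * (M 1F 1F * M 2F 2F - M 1F 2F * M 2F 1F)
       - M 0F 1F * (M 1F 0F * M 2F 2F - M 1F 2F * M 2F 0F)
       + M 0F 2F * (M 1F 0F * M 2F 1F - M 1F 1F * M 2F 0F)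

det₃-cong-mod : ∀ {m} {M M' : Matrix 3 3} → (∀ i j → M i j ≡ M' i j mod m) → det₃ M ≡ det₃ M' mod m
det₃-cong-mod {m} {M} {M'} e =
  ≡mod-+ (≡mod-+ (≡mod-* (e 0F 0F) (det₂ 1F 1F 2F 2F 1F 2F 2F 1F))
                 (≡mod-neg (≡mod-* (e 0F 1F) (det₂ 1F 0F 2F 2F 1F 2F 2F 0F))))
         (≡mod-* (e 0F 2F) (det₂ 1F 0F 2F 1F 1F 1F 2F 0F))
  where
  det₂ : ∀ i j k l p q r s → M i j * M k l - M p q * M r s ≡ M' i j * M' k l - M' p q * M' r s mod m
  det₂ i j k l p q r s = ≡mod-+ (≡mod-* (e i j) (e k l)) (≡mod-neg (≡mod-* (e p q) (e r s)))

private
  det₃-multiplicative : ∀ a₀₀ a₀₁ a₀₂ a₁₀ a₁₁ a₁₂ a₂₀ a₂₁ a₂₂ b₀₀ b₀₁ b₀₂ b₁₀ b₁₁ b₁₂ b₂₀ b₂₁ b₂₂ →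
    let det : ℤ → ℤ → ℤ → ℤ → ℤ → ℤ → ℤ → ℤ → ℤ → ℤ
        det p q r s t u v w x = p * (t * x - u * w) - q * (s * x - u * v) + r * (s * w - t * v)
        dot : ℤ → ℤ → ℤ → ℤ → ℤ → ℤ → ℤ
        dot p q r s t u = p * s + (q * t + (r * u + 0ℤ))
    in det (dot a₀₀ a₀₁ a₀₂ b₀₀ b₁₀ b₂₀) (dot a₀₀ a₀₁ a₀₂ b₀₁ b₁₁ b₂₁) (dot a₀₀ a₀₁ a₀₂ b₀₂ b₁₂ b₂₂)
           (dot a₁₀ a₁₁ a₁₂ b₀₀ b₁₀ b₂₀) (dot a₁₀ a₁₁ a₁₂ b₀₁ b₁₁ b₂₁) (dot a₁₀ a₁₁ a₁₂ b₀₂ b₁₂ b₂₂)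
           (dot a₂₀ a₂₁ a₂₂ b₀₀ b₁₀ b₂₀) (dot a₂₀ a₂₁ a₂₂ b₀₁ b₁₁ b₂₁) (dot a₂₀ a₂₁ a₂₂ b₀₂ b₁₂ b₂₂)
       ≡ det a₀₀ a₀₁ a₀₂ a₁₀ a₁₁ a₁₂ a₂₀ a₂₁ a₂₂ * det b₀₀ b₀₁ b₀₂ b₁₀ b₁₁ b₁₂ b₂₀ b₂₁ b₂₂
  det₃-multiplicative = solve-∀

det₃-· : ∀ (X Y : Matrix 3 3) → det₃ (X · Y) ≡ det₃ X * det₃ Y
det₃-· X Y = det₃-multiplicative
  (X 0F 0F) (X 0F 1F) (X 0F 2F) (X 1F 0F) (X 1F 1F) (X 1F 2F) (X 2F 0F) (X 2F 1F) (X 2F 2F)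
  (Y 0F 0F) (Y 0F 1F) (Y 0F 2F) (Y 1F 0F) (Y 1F 1F) (Y 1F 2F) (Y 2F 0F) (Y 2F 1F) (Y 2F 2F)

minor : Matrix 4 3 → Fin 4 → Matrix 3 3
minor X i = X ∘ F.punchIn i

cofactor : Matrix 4 3 → Fin 4 → ℤ
cofactor X 0F = det₃ (minor X 0F)
cofactor X 1F = - det₃ (minor X 1F)
cofactor X 2F = det₃ (minor X 2F)
cofactor X 3F = - det₃ (minor X 3F)

private
  laplace-repeated-column : ∀ x₀₀ x₀₁ x₀₂ x₁₀ x₁₁ x₁₂ x₂₀ x₂₁ x₂₂ x₃₀ x₃₁ x₃₂ y₀ y₁ y₂ →
    let det : ℤ → ℤ → ℤ → ℤ → ℤ → ℤ → ℤ → ℤ → ℤ → ℤ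
        det p q r s t u v w x = p * (t * x - u * w) - q * (s * x - u * v) + r * (s * w - t * v)
        dot : ℤ → ℤ → ℤ → ℤ
        dot p q r = p * y₀ + (q * y₁ + (r * y₂ + 0ℤ))
    in det x₁₀ x₁₁ x₁₂ x₂₀ x₂₁ x₂₂ x₃₀ x₃₁ x₃₂ * dot x₀₀ x₀₁ x₀₂
       + (- det x₀₀ x₀₁ x₀₂ x₂₀ x₂₁ x₂₂ x₃₀ x₃₁ x₃₂ * dot x₁₀ x₁₁ x₁₂
       + (det x₀₀ x₀₁ x₀₂ x₁₀ x₁₁ x₁₂ x₃₀ x₃₁ x₃₂ * dot x₂₀ x₂₁ x₂₂
       + (- det x₀₀ x₀₁ x₀₂ x₁₀ x₁₁ x₁₂ x₂₀ x₂₁ x₂₂ * dot x₃₀ x₃₁ x₃₂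
       + 0ℤ)))
       ≡ 0ℤ
  laplace-repeated-column = solve-∀

cofactors-annihilate : ∀ (X : Matrix 4 3) (y : Fin 3 → ℤ) →
  sumFin (λ i → cofactor X i * sumFin (λ c → X i c * y c)) ≡ 0ℤ
cofactors-annihilate X y = laplace-repeated-column
  (X 0F 0F) (X 0F 1F) (X 0F 2F) (X 1F 0F) (X 1F 1F) (X 1F 2F)
  (X 2F 0F) (X 2F 1F) (X 2F 2F) (X 3F 0F) (X 3F 1F) (X 3F 2F) (y 0F) (y 1F) (y 2F)

-- The cofactor vector w of X satisfies wᵀX = 0, so wᵀI₄ ≡ wᵀXY = 0 puts det X₃ = −w₃ in mℤ,
-- while det X₃ · det Y₃ ≡ det I₃ = 1.
I₄≡XY-mod⇒∣1 : ∀ {m} (X : Matrix 4 3) (Y : Matrix 3 4) →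
  (∀ i j → idMat i j ≡ (X · Y) i j mod m) → m ∣ 1ℤ
I₄≡XY-mod⇒∣1 {m} X Y I≡XY = Equivalence.to ≡mod-0⇔∣ 1≡0
  where
  open ModReasoning m
  X₃ : Matrix 3 3
  X₃ = minor X 3F
  Y₃ : Matrix 3 3
  Y₃ c j = Y c (F.punchIn 3F j)
  cofactor₃≡0 : cofactor X 3F ≡ 0ℤ mod m
  cofactor₃≡0 = begin
    cofactor X 3F                               ≡⟨ sum-idMatʳ 3F (cofactor X) ⟨
    sumFin (λ i → cofactor X i * idMat i 3F)    ≈⟨ sum-cong-mod (λ i → ≡mod-* (≡mod-refl (cofactor X i)) (I≡XY i 3F)) ⟩
    sumFin (λ i → cofactor X i * (X · Y) i 3F)  ≡⟨ cofactors-annihilate X (λ c → Y c 3F) ⟩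
    0ℤ                                          ∎
  m∣det₃X₃ : m ∣ det₃ X₃
  m∣det₃X₃ = ∣-resp-≡ (ℤP.neg-involutive (det₃ X₃)) (∣m⇒∣-m (Equivalence.to ≡mod-0⇔∣ cofactor₃≡0))
  1≡0 : 1ℤ ≡ 0ℤ mod m
  1≡0 = begin
    1ℤ                                                   ≡⟨⟩
    det₃ (λ i j → idMat (F.punchIn 3F i) (F.punchIn 3F j)) ≈⟨ det₃-cong-mod (λ i j → I≡XY (F.punchIn 3F i) (F.punchIn 3F j)) ⟩
    det₃ (X₃ · Y₃)                                       ≡⟨ det₃-· X₃ Y₃ ⟩
    det₃ X₃ * det₃ Y₃                                    ≈⟨ ≡mod-* (Equivalence.from ≡mod-0⇔∣ m∣det₃X₃) (≡mod-refl (det₃ Y₃)) ⟩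
    0ℤ * det₃ Y₃                                         ≡⟨ ℤP.*-zeroˡ (det₃ Y₃) ⟩
    0ℤ                                                   ∎

factors-through-3-mod⇒∣1 : ∀ {m p q} {M : Matrix p q} (U : Matrix p 3) (V : Matrix 3 q) →
  (∀ i j → M i j ≡ (U · V) i j mod m) →
  (L : Matrix 4 p) (R : Matrix q 4) → (∀ a b → ((L · M) · R) a b ≡ idMat a b) → m ∣ 1ℤ
factors-through-3-mod⇒∣1 {m} {M = M} U V M≡UV L R LMR≡I = I₄≡XY-mod⇒∣1 (L · U) (V · R) I≡XY
  where
  open ModReasoning m
  I≡XY : ∀ a b → idMat a b ≡ ((L · U) · (V · R)) a b mod m
  I≡XY a b = begin
    idMat a b                ≡⟨ LMR≡I a b ⟨
    ((L · M) · R) a b        ≈⟨ ·-cong-mod L R M≡UV a b ⟩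
    ((L · (U · V)) · R) a b  ≡⟨ ·-assoc L (U · V) R a b ⟩
    (L · ((U · V) · R)) a b  ≡⟨ ·-congʳ L (·-assoc U V R) a b ⟩
    (L · (U · (V · R))) a b  ≡⟨ ·-assoc L U (V · R) a b ⟨
    ((L · U) · (V · R)) a b  ∎

-- Elementary row and column operations

dot : ∀ {n} → (Fin n → ℤ) → (Fin n → ℤ) → ℤ
dot v u = sumFin (λ k → v k * u k)

I+uvᵀ : ∀ {n} → (Fin n → ℤ) → (Fin n → ℤ) → Mat n
I+uvᵀ u v i j = idMat i j + u i * v j

I+uvᵀ-·ˡ : ∀ {n p} u v (A : Matrix n p) i j → (I+uvᵀ u v · A) i j ≡ A i j + u i * dot v (λ k → A k j)
I+uvᵀ-·ˡ u v A i j = begin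
  sumFin (λ k → (idMat i k + u i * v k) * A k j)                  ≡⟨ sum-cong (λ k → distrib (idMat i k) (u i) (v k) (A k j)) ⟩
  sumFin (λ k → idMat i k * A k j + u i * (v k * A k j))          ≡⟨ sum-+ (λ k → idMat i k * A k j) (λ k → u i * (v k * A k j)) ⟩
  sumFin (λ k → idMat i k * A k j) + sumFin (λ k → u i * (v k * A k j))
    ≡⟨ cong₂ _+_ (sum-idMatˡ i (λ k → A k j)) (sum-*ˡ (u i) (λ k → v k * A k j)) ⟩
  A i j + u i * dot v (λ k → A k j)                               ∎
  where
  open ≡-Reasoning
  distrib : ∀ δ a b c → (δ + a * b) * c ≡ δ * c + a * (b * c)
  distrib = solve-∀

I+uvᵀ-·ʳ : ∀ {m n} u v (A : Matrix m n) i j → (A · I+uvᵀ u v) i j ≡ A i j + dot (A i) u * v j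
I+uvᵀ-·ʳ u v A i j = begin
  sumFin (λ k → A i k * (idMat k j + u k * v j))                  ≡⟨ sum-cong (λ k → distrib (A i k) (idMat k j) (u k) (v j)) ⟩
  sumFin (λ k → A i k * idMat k j + A i k * u k * v j)            ≡⟨ sum-+ (λ k → A i k * idMat k j) (λ k → A i k * u k * v j) ⟩
  sumFin (λ k → A i k * idMat k j) + sumFin (λ k → A i k * u k * v j)
    ≡⟨ cong₂ _+_ (sum-idMatʳ j (A i)) (sum-*ʳ (v j) (λ k → A i k * u k)) ⟩
  A i j + dot (A i) u * v j                                       ∎
  where
  open ≡-Reasoning
  distrib : ∀ a δ b c → a * (δ + b * c) ≡ a * δ + a * b * c
  distrib = solve-∀

I+uvᵀ-inverse : ∀ {n} (u u' v : Fin n → ℤ) → (∀ i → u' i + u i + u i * dot v u' ≡ 0ℤ) →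
  (I+uvᵀ u v ⊗ I+uvᵀ u' v) ≈M idMat
I+uvᵀ-inverse u u' v cancel i j = begin
  (I+uvᵀ u v ⊗ I+uvᵀ u' v) i j                                ≡⟨ I+uvᵀ-·ˡ u v (I+uvᵀ u' v) i j ⟩
  I+uvᵀ u' v i j + u i * dot v (λ k → I+uvᵀ u' v k j)          ≡⟨ cong (λ s → I+uvᵀ u' v i j + u i * s) (I+uvᵀ-·ʳ u' v (λ _ → v) i j) ⟩
  idMat i j + u' i * v j + u i * (v j + dot v u' * v j)       ≡⟨ collect (idMat i j) (u' i) (u i) (v j) (dot v u') ⟩
  idMat i j + (u' i + u i + u i * dot v u') * v j             ≡⟨ cong (λ c → idMat i j + c * v j) (cancel i) ⟩
  idMat i j + 0ℤ * v j                                        ≡⟨ cong (_+_ (idMat i j)) (ℤP.*-zeroˡ (v j)) ⟩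
  idMat i j + 0ℤ                                              ≡⟨ ℤP.+-identityʳ (idMat i j) ⟩
  idMat i j                                                   ∎
  where
  open ≡-Reasoning
  collect : ∀ δ a b c d → δ + a * c + b * (c + d * c) ≡ δ + (a + b + b * d) * c
  collect = solve-∀

transvection-unimodular : ∀ {n} (u v : Fin n → ℤ) → dot v u ≡ 0ℤ → Unimodular (I+uvᵀ u v)
transvection-unimodular {n} u v vu≡0 =
  I+uvᵀ -u v ,
  I+uvᵀ-inverse u -u v (λ i → vanish (u i) v-u≡0 refl) ,
  I+uvᵀ-inverse -u u v (λ i → vanish (- u i) vu≡0 (sym (ℤP.neg-involutive (u i))))
  where
  -u : Fin n → ℤ
  -u k = - u k
  v-u≡0 : dot v -u ≡ 0ℤ
  v-u≡0 = begin
    sumFin (λ k → v k * - u k)        ≡⟨ sum-cong (λ k → sym (ℤP.neg-distribʳ-* (v k) (u k))) ⟩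
    sumFin (λ k → - (v k * u k))      ≡⟨ sum-cong (λ k → sym (ℤP.-1*i≡-i (v k * u k))) ⟩
    sumFin (λ k → -1ℤ * (v k * u k))  ≡⟨ sum-*ˡ -1ℤ (λ k → v k * u k) ⟩
    -1ℤ * dot v u                     ≡⟨ cong (-1ℤ *_) vu≡0 ⟩
    0ℤ                                ∎
    where open ≡-Reasoning
  cancel : ∀ a → - a + a + a * 0ℤ ≡ 0ℤ
  cancel = solve-∀
  vanish : ∀ a {b d} → d ≡ 0ℤ → b ≡ - a → b + a + a * d ≡ 0ℤ
  vanish a refl refl = cancel a

reflection-unimodular : ∀ {n} (u v : Fin n → ℤ) → dot v u ≡ - (+ 2) → Unimodular (I+uvᵀ u v)
reflection-unimodular u v vu≡-2 = I+uvᵀ u v , involution , involution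
  where
  vanish : ∀ a → a + a + a * - (+ 2) ≡ 0ℤ
  vanish = solve-∀
  involution : (I+uvᵀ u v ⊗ I+uvᵀ u v) ≈M idMat
  involution = I+uvᵀ-inverse u u v (λ i → trans (cong (λ d → u i + u i + u i * d) vu≡-2) (vanish (u i)))

add-multiples-of-row : ∀ {n} (A : Mat n) (u : Fin n → ℤ) (k : Fin n) → u k ≡ 0ℤ →
  A ∼ (λ i j → A i j + u i * A k j)
add-multiples-of-row A u k uk≡0 =
  ∼-resp-≈M (∼-⊗ˡ (I+uvᵀ u (idMat k)) (transvection-unimodular u (idMat k) (trans (sum-idMatˡ k u) uk≡0)))
            (λ i j → trans (I+uvᵀ-·ˡ u (idMat k) A i j) (cong (λ s → A i j + u i * s) (sum-idMatˡ k (λ l → A l j))))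

add-multiples-of-column : ∀ {n} (A : Mat n) (u : Fin n → ℤ) (k : Fin n) → u k ≡ 0ℤ →
  A ∼ (λ i j → A i j + A i k * u j)
add-multiples-of-column {n} A u k uk≡0 =
  ∼-resp-≈M (∼-⊗ʳ (I+uvᵀ eₖ u) (transvection-unimodular eₖ u (trans (sum-idMatʳ k u) uk≡0)))
            (λ i j → trans (I+uvᵀ-·ʳ eₖ u A i j) (cong (λ s → A i j + s * u j) (sum-idMatʳ k (A i))))
  where
  eₖ : Fin n → ℤ
  eₖ l = idMat l k

negateRow₀ : ∀ {n} → Mat (suc n) → Mat (suc n)
negateRow₀ A zero    j = - A zero j
negateRow₀ A (suc i) j = A (suc i) j

negate-row₀ : ∀ {n} (A : Mat (suc n)) → A ∼ negateRow₀ A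
negate-row₀ {n} A =
  ∼-resp-≈M (∼-⊗ˡ (I+uvᵀ u e₀) (reflection-unimodular u e₀ (sum-idMatˡ 0F u))) negated
  where
  e₀ : Fin (suc n) → ℤ
  e₀ = idMat 0F
  u : Fin (suc n) → ℤ
  u zero    = - (+ 2)
  u (suc _) = 0ℤ
  reflect : ∀ a → a + - (+ 2) * a ≡ - a
  reflect = solve-∀
  negated : (I+uvᵀ u e₀ ⊗ A) ≈M negateRow₀ A
  negated i j = trans (I+uvᵀ-·ˡ u e₀ A i j) (trans (cong (λ s → A i j + u i * s) (sum-idMatˡ 0F (λ l → A l j))) (by-row i))
    where
    by-row : ∀ i → A i j + u i * A 0F j ≡ negateRow₀ A i j
    by-row zero    = reflect (A zero j)
    by-row (suc i) = trans (cong (_+_ (A (suc i) j)) (ℤP.*-zeroˡ (A 0F j))) (ℤP.+-identityʳ _)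

permutationMatrix : ∀ {n} → Permutation′ n → Mat n
permutationMatrix π i j = idMat (π ⟨$⟩ʳ i) j

permutationMatrix-·ˡ : ∀ {n p} (π : Permutation′ n) (A : Matrix n p) i j →
  (permutationMatrix π · A) i j ≡ A (π ⟨$⟩ʳ i) j
permutationMatrix-·ˡ π A i j = sum-idMatˡ (π ⟨$⟩ʳ i) (λ k → A k j)

permutationMatrix-·ʳ : ∀ {m n} (π : Permutation′ n) (A : Matrix m n) i j →
  (A · permutationMatrix π) i j ≡ A i (π ⟨$⟩ˡ j)
permutationMatrix-·ʳ π A i j = begin
  sumFin (λ k → A i k * idMat (π ⟨$⟩ʳ k) j)     ≡⟨ sum-supportedAt (π ⟨$⟩ˡ j) _ off-support ⟩
  A i (π ⟨$⟩ˡ j) * idMat (π ⟨$⟩ʳ (π ⟨$⟩ˡ j)) j   ≡⟨ cong (λ l → A i (π ⟨$⟩ˡ j) * idMat l j) (inverseʳ π) ⟩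
  A i (π ⟨$⟩ˡ j) * idMat j j                    ≡⟨ cong (A i (π ⟨$⟩ˡ j) *_) (idMat-diag j) ⟩
  A i (π ⟨$⟩ˡ j) * 1ℤ                           ≡⟨ ℤP.*-identityʳ _ ⟩
  A i (π ⟨$⟩ˡ j)                                ∎
  where
  open ≡-Reasoning
  off-support : ∀ k → k ≢ π ⟨$⟩ˡ j → A i k * idMat (π ⟨$⟩ʳ k) j ≡ 0ℤ
  off-support k k≢ = trans (cong (A i k *_) (idMat-off (λ e → k≢ (trans (sym (inverseˡ π)) (cong (π ⟨$⟩ˡ_) e)))))
                           (ℤP.*-zeroʳ (A i k))

permutationMatrix-unimodular : ∀ {n} (π : Permutation′ n) → Unimodular (permutationMatrix π)
permutationMatrix-unimodular π = permutationMatrix (flip π) , inverse π , inverse (flip π)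
  where
  inverse : ∀ σ → (permutationMatrix σ ⊗ permutationMatrix (flip σ)) ≈M idMat
  inverse σ i j = trans (permutationMatrix-·ˡ σ (permutationMatrix (flip σ)) i j)
                        (cong (λ l → idMat l j) (inverseˡ σ))

permute-rows : ∀ {n} (π : Permutation′ n) (A : Mat n) → A ∼ (λ i j → A (π ⟨$⟩ʳ i) j)
permute-rows π A =
  ∼-resp-≈M (∼-⊗ˡ (permutationMatrix π) (permutationMatrix-unimodular π)) (permutationMatrix-·ˡ π A)

permute-columns : ∀ {n} (π : Permutation′ n) (A : Mat n) → A ∼ (λ i j → A i (π ⟨$⟩ʳ j))
permute-columns π A =
  ∼-resp-≈M (∼-⊗ʳ (permutationMatrix (flip π)) (permutationMatrix-unimodular (flip π)))
            (permutationMatrix-·ʳ (flip π) A)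

-- Existence of the Smith normal form

all-or-counterexample : ∀ {n p} {P : Pred (Fin n) p} → Decidable P → (∀ i → P i) ⊎ ∃ (¬_ ∘ P)
all-or-counterexample {n} P? with FP.all? P?
... | yes all = inj₁ all
... | no ¬all = inj₂ (FP.¬∀⟶∃¬ n _ P? ¬all)

all-or-counterexample₂ : ∀ {m n} {P : Fin m → Fin n → Set} → (∀ i j → Dec (P i j)) →
  (∀ i j → P i j) ⊎ ∃₂ λ i j → ¬ P i j
all-or-counterexample₂ P? with all-or-counterexample (λ i → FP.all? (P? i))
... | inj₁ all = inj₁ all
... | inj₂ (i , ¬all) = inj₂ (i , FP.¬∀⟶∃¬ _ _ (P? i) ¬all)

record Remainder (a x : ℤ) : Set where
  field
    quotient     : ℤ
    remainder≢0  : x - quotient * a ≢ 0ℤ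
    remainder<   : ∣ x - quotient * a ∣ ℕ.< ∣ a ∣

euclidean-step : ∀ {a} x → a ≢ 0ℤ → ¬ (a ∣ x) → Remainder a x
euclidean-step {a} x a≢0 a∤x = record
  { quotient    = x / a
  ; remainder≢0 = r≢0
  ; remainder<  = subst (λ r → ∣ r ∣ ℕ.< ∣ a ∣) (sym x-qa≡r) (n%d<d x a)
  }
  where
  instance _ = ≢-nonZero a≢0
  cancel : ∀ r s → r + s - s ≡ r
  cancel = solve-∀
  x-qa≡r : x - (x / a) * a ≡ + (x % a)
  x-qa≡r = trans (cong (λ y → y - (x / a) * a) (a≡a%n+[a/n]*n x a)) (cancel (+ (x % a)) ((x / a) * a))
  r≢0 : x - (x / a) * a ≢ 0ℤ
  r≢0 r≡0 = a∤x (divides (x / a) (trans (a≡a%n+[a/n]*n x a)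
                   (trans (cong (_+ (x / a) * a) (trans (sym x-qa≡r) r≡0)) (ℤP.+-identityˡ _))))

record Smaller {n} (A : Mat (suc n)) : Set where
  constructor smaller
  field
    {B}       : Mat (suc n)
    A∼B       : A ∼ B
    corner≢0  : B 0F 0F ≢ 0ℤ
    decreases : ∣ B 0F 0F ∣ ℕ.< ∣ A 0F 0F ∣

smaller-via : ∀ {n} {A A' : Mat (suc n)} → A ∼ A' → A' 0F 0F ≡ A 0F 0F → Smaller A' → Smaller A
smaller-via A∼A' A'₀₀≡A₀₀ (smaller A'∼B b≢0 dec) =
  smaller (∼-trans A∼A' A'∼B) b≢0 (subst (λ a → _ ℕ.< ∣ a ∣) A'₀₀≡A₀₀ dec)

private
  remove-unit : ∀ x q a → x + - q * 1ℤ * a ≡ x - q * a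
  remove-unit = solve-∀

reduce-below-corner : ∀ {n} (A : Mat (suc n)) → A 0F 0F ≢ 0ℤ →
  (i : Fin n) → ¬ (A 0F 0F ∣ A (suc i) 0F) → Smaller A
reduce-below-corner {n} A a≢0 i a∤x =
  smaller {B = B} A∼B (remainder≢0 ∘ trans (sym corner≡r)) (subst (λ r → ∣ r ∣ ℕ.< _) (sym corner≡r) remainder<)
  where
  open Remainder (euclidean-step (A (suc i) 0F) a≢0 a∤x) renaming (quotient to q)
  u : Fin (suc n) → ℤ
  u l = - q * idMat (suc i) l
  A₁ B : Mat (suc n)
  A₁ l m = A l m + u l * A 0F m
  B l m = A₁ (transpose 0F (suc i) ⟨$⟩ʳ l) m
  A∼B : A ∼ B
  A∼B = ∼-trans (add-multiples-of-row A u 0F (ℤP.*-zeroʳ (- q))) (permute-rows (transpose 0F (suc i)) A₁)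
  corner≡r : B 0F 0F ≡ A (suc i) 0F - q * A 0F 0F
  corner≡r = trans (cong (λ δ → A (suc i) 0F + - q * δ * A 0F 0F) (idMat-diag (suc i)))
                   (remove-unit (A (suc i) 0F) q (A 0F 0F))

reduce-right-of-corner : ∀ {n} (A : Mat (suc n)) → A 0F 0F ≢ 0ℤ →
  (j : Fin n) → ¬ (A 0F 0F ∣ A 0F (suc j)) → Smaller A
reduce-right-of-corner {n} A a≢0 j a∤x =
  smaller {B = B} A∼B (remainder≢0 ∘ trans (sym corner≡r)) (subst (λ r → ∣ r ∣ ℕ.< _) (sym corner≡r) remainder<)
  where
  open Remainder (euclidean-step (A 0F (suc j)) a≢0 a∤x) renaming (quotient to q)
  u : Fin (suc n) → ℤ
  u l = - q * idMat (suc j) l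
  A₁ B : Mat (suc n)
  A₁ l m = A l m + A l 0F * u m
  B l m = A₁ l (transpose 0F (suc j) ⟨$⟩ʳ m)
  A∼B : A ∼ B
  A∼B = ∼-trans (add-multiples-of-column A u 0F (ℤP.*-zeroʳ (- q))) (permute-columns (transpose 0F (suc j)) A₁)
  corner≡r : B 0F 0F ≡ A 0F (suc j) - q * A 0F 0F
  corner≡r = trans (cong (λ δ → A 0F (suc j) + A 0F 0F * (- q * δ)) (idMat-diag (suc j)))
                   (trans (cong (_+_ (A 0F (suc j))) (ℤP.*-comm (A 0F 0F) _)) (remove-unit (A 0F (suc j)) q (A 0F 0F)))

record CrossCleared {n} (A : Mat (suc n)) : Set where
  constructor cross-cleared
  field
    {C}          : Mat (suc n)
    A∼C          : A ∼ C
    same-corner  : C 0F 0F ≡ A 0F 0F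
    row-clear    : ∀ j → C 0F (suc j) ≡ 0ℤ
    column-clear : ∀ i → C (suc i) 0F ≡ 0ℤ

clear-cross : ∀ {n} (A : Mat (suc n)) →
  (∀ i → A 0F 0F ∣ A (suc i) 0F) → (∀ j → A 0F 0F ∣ A 0F (suc j)) → CrossCleared A
clear-cross {n} A a∣col a∣row =
  cross-cleared (∼-trans (add-multiples-of-row A u 0F refl) (add-multiples-of-column A₁ v 0F refl))
                (corner (A 0F 0F)) row-clear column-clear
  where
  open _∣_ using (quotient; equality)
  u v : Fin (suc n) → ℤ
  u zero    = 0ℤ
  u (suc i) = - quotient (a∣col i)
  v zero    = 0ℤ
  v (suc j) = - quotient (a∣row j)
  A₁ : Mat (suc n)
  A₁ i j = A i j + u i * A 0F j
  -- These identities are stated in the shape in which the entries of A₂ unfold.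
  corner : ∀ a → (a + 0ℤ * a) + (a + 0ℤ * a) * 0ℤ ≡ a
  corner = solve-∀
  row-vanishes : ∀ q a → (q * a + 0ℤ * (q * a)) + (a + 0ℤ * a) * (- q) ≡ 0ℤ
  row-vanishes = solve-∀
  column-vanishes : ∀ q a → (q * a + (- q) * a) + (q * a + (- q) * a) * 0ℤ ≡ 0ℤ
  column-vanishes = solve-∀
  A₂ : Mat (suc n)
  A₂ i j = A₁ i j + A₁ i 0F * v j
  row-clear : ∀ j → A₂ 0F (suc j) ≡ 0ℤ
  row-clear j = trans (cong (λ x → (x + 0ℤ * x) + (A 0F 0F + 0ℤ * A 0F 0F) * v (suc j)) (equality (a∣row j)))
                      (row-vanishes (quotient (a∣row j)) (A 0F 0F))
  column-clear : ∀ i → A₂ (suc i) 0F ≡ 0ℤ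
  column-clear i = trans (cong (λ x → (x + u (suc i) * A 0F 0F) + (x + u (suc i) * A 0F 0F) * 0ℤ) (equality (a∣col i)))
                         (column-vanishes (quotient (a∣col i)) (A 0F 0F))

reduce-interior : ∀ {n} (C : Mat (suc n)) → C 0F 0F ≢ 0ℤ →
  (∀ i → C (suc i) 0F ≡ 0ℤ) → (∀ j → C 0F (suc j) ≡ 0ℤ) →
  (i j : Fin n) → ¬ (C 0F 0F ∣ C (suc i) (suc j)) → Smaller C
reduce-interior {n} C c≢0 column-clear row-clear i j c∤x =
  smaller-via (add-multiples-of-row C (idMat 0F) (suc i) refl) corner≡
    (reduce-right-of-corner C′ (c≢0 ∘ trans (sym corner≡)) j (c∤x ∘ subst₂ _∣_ corner≡ entry≡))
  where
  C′ : Mat (suc n)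
  C′ l m = C l m + idMat 0F l * C (suc i) m
  add-zero : ∀ x → x + 1ℤ * 0ℤ ≡ x
  add-zero = solve-∀
  zero-add : ∀ x → 0ℤ + 1ℤ * x ≡ x
  zero-add = solve-∀
  corner≡ : C′ 0F 0F ≡ C 0F 0F
  corner≡ = trans (cong (λ x → C 0F 0F + 1ℤ * x) (column-clear i)) (add-zero (C 0F 0F))
  entry≡ : C′ 0F (suc j) ≡ C (suc i) (suc j)
  entry≡ = trans (cong (λ x → x + 1ℤ * C (suc i) (suc j)) (row-clear j)) (zero-add _)

record IsPivoted {n} (B : Mat (suc n)) : Set where
  field
    row-clear        : ∀ j → B 0F (suc j) ≡ 0ℤ
    column-clear     : ∀ i → B (suc i) 0F ≡ 0ℤ
    corner∣interior  : ∀ i j → B 0F 0F ∣ B (suc i) (suc j)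

Pivotable : ∀ {n} → Mat (suc n) → Set
Pivotable A = ∃ λ B → A ∼ B × IsPivoted B

-- k bounds ∣A₀₀∣, which every reduction step decreases.
pivot : ∀ {n} k (A : Mat (suc n)) → A 0F 0F ≢ 0ℤ → ∣ A 0F 0F ∣ ℕ.≤ k → Pivotable A
pivot zero    A a≢0 bound = ⊥-elim (a≢0 (ℤP.∣i∣≡0⇒i≡0 (ℕP.n≤0⇒n≡0 bound)))
pivot (suc k) A a≢0 bound =
  by-column (all-or-counterexample (λ i → A 0F 0F ∣? A (suc i) 0F))
            (all-or-counterexample (λ j → A 0F 0F ∣? A 0F (suc j)))
  where
  descend : Smaller A → Pivotable A
  descend (smaller {B} A∼B b≢0 dec) =
    let B′ , B∼B′ , pivoted = pivot k B b≢0 (ℕP.≤-pred (ℕP.≤-trans dec bound))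
    in  B′ , ∼-trans A∼B B∼B′ , pivoted
  by-interior : (cl : CrossCleared A) → let open CrossCleared cl in
    (∀ i j → C 0F 0F ∣ C (suc i) (suc j)) ⊎ ∃₂ (λ i j → ¬ C 0F 0F ∣ C (suc i) (suc j)) → Pivotable A
  by-interior (cross-cleared {C} A∼C _ row-clear column-clear) (inj₁ c∣) =
    C , A∼C , record { row-clear = row-clear ; column-clear = column-clear ; corner∣interior = c∣ }
  by-interior (cross-cleared {C} A∼C same-corner row-clear column-clear) (inj₂ (i , j , c∤)) =
    descend (smaller-via A∼C same-corner
              (reduce-interior C (a≢0 ∘ trans (sym same-corner)) column-clear row-clear i j c∤))
  by-column : (∀ i → A 0F 0F ∣ A (suc i) 0F) ⊎ ∃ (λ i → ¬ A 0F 0F ∣ A (suc i) 0F) →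
              (∀ j → A 0F 0F ∣ A 0F (suc j)) ⊎ ∃ (λ j → ¬ A 0F 0F ∣ A 0F (suc j)) → Pivotable A
  by-column (inj₂ (i , a∤)) _             = descend (reduce-below-corner A a≢0 i a∤)
  by-column (inj₁ _)        (inj₂ (j , a∤)) = descend (reduce-right-of-corner A a≢0 j a∤)
  by-column (inj₁ a∣col)    (inj₁ a∣row)    =
    let cl = clear-cross A a∣col a∣row; open CrossCleared cl in
    by-interior cl (all-or-counterexample₂ (λ i j → C 0F 0F ∣? C (suc i) (suc j)))

infixr 5 _⊕_
_⊕_ : ∀ {n} → ℤ → Mat n → Mat (suc n)
(a ⊕ M) zero    zero    = a
(a ⊕ M) zero    (suc j) = 0ℤ
(a ⊕ M) (suc i) zero    = 0ℤ
(a ⊕ M) (suc i) (suc j) = M i j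

⊕-⊗ : ∀ {n} a b (M N : Mat n) → ((a ⊕ M) ⊗ (b ⊕ N)) ≈M ((a * b) ⊕ (M ⊗ N))
⊕-⊗ {n} a b M N zero    zero    = trans (cong (_+_ (a * b)) (sum-zero {n} (λ k → ℤP.*-zeroˡ 0ℤ))) (ℤP.+-identityʳ _)
⊕-⊗ a b M N zero    (suc j) = trans (cong (_+_ (a * 0ℤ)) (sum-zero (λ k → ℤP.*-zeroˡ (N k j))))
                                    (trans (ℤP.+-identityʳ _) (ℤP.*-zeroʳ a))
⊕-⊗ a b M N (suc i) zero    = trans (cong (_+_ (0ℤ * b)) (sum-zero (λ k → ℤP.*-zeroʳ (M i k))))
                                    (trans (ℤP.+-identityʳ _) (ℤP.*-zeroˡ b))
⊕-⊗ a b M N (suc i) (suc j) = trans (cong (_+ (M ⊗ N) i j) (ℤP.*-zeroˡ 0ℤ)) (ℤP.+-identityˡ _)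

⊕-cong : ∀ {n} {a b} {M N : Mat n} → a ≡ b → M ≈M N → (a ⊕ M) ≈M (b ⊕ N)
⊕-cong a≡b M≈N zero    zero    = a≡b
⊕-cong a≡b M≈N zero    (suc j) = refl
⊕-cong a≡b M≈N (suc i) zero    = refl
⊕-cong a≡b M≈N (suc i) (suc j) = M≈N i j

1⊕idMat≈idMat : ∀ {n} → (1ℤ ⊕ idMat {n}) ≈M idMat
1⊕idMat≈idMat zero    zero    = refl
1⊕idMat≈idMat zero    (suc j) = refl
1⊕idMat≈idMat (suc i) zero    = refl
1⊕idMat≈idMat (suc i) (suc j) = sym (idMat-suc i j)

1⊕-unimodular : ∀ {n} {P : Mat n} → Unimodular P → Unimodular (1ℤ ⊕ P)
1⊕-unimodular {P = P} (P⁻¹ , PP⁻¹ , P⁻¹P) = 1ℤ ⊕ P⁻¹ , inverse PP⁻¹ , inverse P⁻¹P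
  where
  inverse : ∀ {M N} → (M ⊗ N) ≈M idMat → ((1ℤ ⊕ M) ⊗ (1ℤ ⊕ N)) ≈M idMat
  inverse {M} {N} MN≈I i j =
    trans (⊕-⊗ 1ℤ 1ℤ M N i j) (trans (⊕-cong refl MN≈I i j) (1⊕idMat≈idMat i j))

⊕-∼ : ∀ {n} (b : ℤ) {C D : Mat n} → C ∼ D → (b ⊕ C) ∼ (b ⊕ D)
⊕-∼ b {C} {D} (equivalent P Q uP uQ PCQ≈D) =
  equivalent (1ℤ ⊕ P) (1ℤ ⊕ Q) (1⊕-unimodular uP) (1⊕-unimodular uQ) chain
  where
  open MatReasoning
  chain : (((1ℤ ⊕ P) ⊗ (b ⊕ C)) ⊗ (1ℤ ⊕ Q)) ≈M (b ⊕ D)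
  chain = begin
    ((1ℤ ⊕ P) ⊗ (b ⊕ C)) ⊗ (1ℤ ⊕ Q)  ≈⟨ ·-congˡ (1ℤ ⊕ Q) (⊕-⊗ 1ℤ b P C) ⟩
    ((1ℤ * b) ⊕ (P ⊗ C)) ⊗ (1ℤ ⊕ Q)  ≈⟨ ⊕-⊗ (1ℤ * b) 1ℤ (P ⊗ C) Q ⟩
    (1ℤ * b * 1ℤ) ⊕ ((P ⊗ C) ⊗ Q)    ≈⟨ ⊕-cong (trans (ℤP.*-identityʳ _) (ℤP.*-identityˡ b)) PCQ≈D ⟩
    b ⊕ D                            ∎

∣-sum : ∀ {m n} {f : Fin n → ℤ} → (∀ i → m ∣ f i) → m ∣ sumFin f
∣-sum {m} {zero}  _   = ∣0 m
∣-sum {m} {suc n} m∣f = ∣m∣n⇒∣m+n (m∣f zero) (∣-sum (m∣f ∘ suc))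

∣-∼ : ∀ {n m} {A B : Mat n} → A ∼ B → (∀ i j → m ∣ A i j) → ∀ i j → m ∣ B i j
∣-∼ {A = A} (equivalent P Q _ _ PAQ≈B) m∣A i j =
  ∣-resp-≡ (PAQ≈B i j) (∣-sum (λ k → ∣m⇒∣m*n (Q k j) (∣-sum (λ l → ∣n⇒∣m*n (P i l) (m∣A l k)))))

record CornerSplit {n} (A : Mat (suc n)) : Set where
  constructor corner-split
  field
    corner       : ℕ
    rest         : Mat n
    split        : A ∼ (+ corner ⊕ rest)
    corner∣rest  : ∀ i j → + corner ∣ rest i j

pivoted⇒corner-split : ∀ {n} {A B : Mat (suc n)} → A ∼ B → IsPivoted B → CornerSplit A
pivoted⇒corner-split {n} {A} {B} A∼B pivoted =
  corner-split ∣ B 0F 0F ∣ interior (∼-trans A∼B (by-sign (B 0F 0F) refl))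
    (λ i j → ∣-trans ∣m∣∣m (corner∣interior i j))
  where
  open IsPivoted pivoted
  interior : Mat n
  interior i j = B (suc i) (suc j)
  by-sign : ∀ c → B 0F 0F ≡ c → B ∼ (+ ∣ c ∣ ⊕ interior)
  by-sign (+ b)     b₀₀≡c = ∼-resp-≈M ∼-refl split
    where
    split : B ≈M (+ b ⊕ interior)
    split zero    zero    = b₀₀≡c
    split zero    (suc j) = row-clear j
    split (suc i) zero    = column-clear i
    split (suc i) (suc j) = refl
  by-sign -[1+ b ] b₀₀≡c = ∼-resp-≈M (negate-row₀ B) split
    where
    split : negateRow₀ B ≈M (+ suc b ⊕ interior)
    split zero    zero    = cong -_ b₀₀≡c
    split zero    (suc j) = cong -_ (row-clear j)
    split (suc i) zero    = column-clear i
    split (suc i) (suc j) = refl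

corner-split-of-nonzero : ∀ {n} (A : Mat (suc n)) (i j : Fin (suc n)) → A i j ≢ 0ℤ → CornerSplit A
corner-split-of-nonzero {n} A i j aᵢⱼ≢0 =
  let B , A′∼B , pivoted = pivot ∣ A i j ∣ A′ aᵢⱼ≢0 ℕP.≤-refl
  in  pivoted⇒corner-split (∼-trans A∼A′ A′∼B) pivoted
  where
  A′ : Mat (suc n)
  A′ l m = A (transpose 0F i ⟨$⟩ʳ l) (transpose 0F j ⟨$⟩ʳ m)
  A∼A′ : A ∼ A′
  A∼A′ = ∼-trans (permute-rows (transpose 0F i) A) (permute-columns (transpose 0F j) (λ l m → A (transpose 0F i ⟨$⟩ʳ l) m))

zero-isSmithForm : ∀ {n} {A : Mat n} → (∀ i j → A i j ≡ 0ℤ) → IsSmithForm A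
zero-isSmithForm A≡0 =
  (λ i j _ → A≡0 i j) ,
  (λ i → subst (0ℤ ℤ.≤_) (sym (A≡0 i i)) ℤP.≤-refl) ,
  (λ i j _ → subst₂ ℤD._∣_ (sym (A≡0 i i)) (sym (A≡0 j j)) ℕD.∣-refl)

⊕-isSmithForm : ∀ {n} b {D : Mat n} → IsSmithForm D → (∀ i j → + b ∣ D i j) → IsSmithForm (+ b ⊕ D)
⊕-isSmithForm b {D} (diagonal , nonneg , chain) b∣D = diagonal′ , nonneg′ , chain′
  where
  diagonal′ : ∀ i j → i ≢ j → (+ b ⊕ D) i j ≡ 0ℤ
  diagonal′ zero    zero    i≢j = ⊥-elim (i≢j refl)
  diagonal′ zero    (suc j) _   = refl
  diagonal′ (suc i) zero    _   = refl
  diagonal′ (suc i) (suc j) i≢j = diagonal i j (i≢j ∘ cong suc)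
  nonneg′ : ∀ i → 0ℤ ℤ.≤ (+ b ⊕ D) i i
  nonneg′ zero    = ℤ.+≤+ z≤n
  nonneg′ (suc i) = nonneg i
  chain′ : ∀ i j → toℕ i ≤ toℕ j → (+ b ⊕ D) i i ℤD.∣ (+ b ⊕ D) j j
  chain′ zero    zero    _         = ℕD.∣-refl
  chain′ zero    (suc j) _         = ∣⇒∣ᵤ (b∣D j j)
  chain′ (suc i) (suc j) (s≤s i≤j) = chain i j i≤j

smith-normal-form : ∀ n (A : Mat n) → ∃ λ D → IsSmithForm D × A ∼ D
smith-normal-form zero    A = A , ((λ ()) , (λ ()) , (λ ())) , ∼-refl
smith-normal-form (suc n) A with all-or-counterexample₂ (λ i j → A i j ℤ.≟ 0ℤ)
... | inj₁ A≡0              = A , zero-isSmithForm A≡0 , ∼-refl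
... | inj₂ (i , j , aᵢⱼ≢0) =
  let corner-split b C A∼b⊕C b∣C = corner-split-of-nonzero A i j aᵢⱼ≢0
      D , D-smith , C∼D          = smith-normal-form n C
  in  + b ⊕ D , ⊕-isSmithForm b D-smith (∣-∼ C∼D b∣C) , ∼-trans A∼b⊕C (⊕-∼ (+ b) C∼D)

-- Graphs

P₄-paw-K₅-free : ∀ {n} → Adj n → Set
P₄-paw-K₅-free G = ¬ IsInducedSubgraph P₄ G × ¬ IsInducedSubgraph paw G × ¬ IsInducedSubgraph K₅ G

induced-subgraph-size : ∀ {k n} (H : Adj k) (G : Adj n) → IsInducedSubgraph H G → k ≤ n
induced-subgraph-size H G (_ , injective , _) = FP.injective⇒≤ injective

P₄-paw-K₅-free-small : ∀ {n} (G : Adj n) → n ℕ.< 4 → P₄-paw-K₅-free G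
P₄-paw-K₅-free-small G n<4 =
  ℕP.<⇒≱ n<4 ∘ induced-subgraph-size P₄ G ,
  ℕP.<⇒≱ n<4 ∘ induced-subgraph-size paw G ,
  ℕP.<⇒≱ (ℕP.m<n⇒m<1+n n<4) ∘ induced-subgraph-size K₅ G

TwinFree : ∀ {k} → Adj k → Set
TwinFree H = ∀ a b → (∀ w → H a w ≡ H b w) → a ≡ b

twinFree? : ∀ {k} (H : Adj k) → Dec (TwinFree H)
twinFree? H = FP.all? λ a → FP.all? λ b → FP.all? (λ w → H a w BoolP.≟ H b w) →-dec (a F.≟ b)

isSimple? : ∀ {k} (H : Adj k) → Dec (IsSimple H)
isSimple? H = Dec.map′ (λ (s , l) → record { symmetric = s ; loopless = l })
                       (λ S → IsSimple.symmetric S , IsSimple.loopless S)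
                       (FP.all? (λ i → FP.all? (λ j → H i j BoolP.≟ H j i)) ×-dec FP.all? (λ i → H i i BoolP.≟ false))

embedding-of-twinFree : ∀ {k n} {H : Adj k} {G : Adj n} → TwinFree H →
  (f : Fin k → Fin n) → (∀ a b → H a b ≡ G (f a) (f b)) → IsInducedSubgraph H G
embedding-of-twinFree {H = H} {G} twin-free f H≡Gf = f , injective , H≡Gf
  where
  injective : Injective _≡_ _≡_ f
  injective {a} {b} fa≡fb = twin-free a b (λ w → trans (H≡Gf a w) (trans (cong (λ x → G x (f w)) fa≡fb) (sym (H≡Gf b w))))

induced₄ : ∀ {n} {H : Adj 4} {G : Adj n} → IsSimple H → TwinFree H → IsSimple G →
  (v : Vec (Fin n) 4) → let f = lookup v in
  H 0F 1F ≡ G (f 0F) (f 1F) → H 0F 2F ≡ G (f 0F) (f 2F) → H 0F 3F ≡ G (f 0F) (f 3F) →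
  H 1F 2F ≡ G (f 1F) (f 2F) → H 1F 3F ≡ G (f 1F) (f 3F) → H 2F 3F ≡ G (f 2F) (f 3F) →
  IsInducedSubgraph H G
induced₄ {n} {H} {G} H-simple twin-free G-simple v e01 e02 e03 e12 e13 e23 =
  embedding-of-twinFree {H = H} {G} twin-free f H≡Gf
  where
  f : Fin 4 → Fin n
  f = lookup v
  flip-edge : ∀ {a b x y} → H a b ≡ G x y → H b a ≡ G y x
  flip-edge {a} {b} {x} {y} e = trans (IsSimple.symmetric H-simple b a) (trans e (IsSimple.symmetric G-simple x y))
  diagonal : ∀ a → H a a ≡ G (f a) (f a)
  diagonal a = trans (IsSimple.loopless H-simple a) (sym (IsSimple.loopless G-simple (f a)))
  H≡Gf : ∀ a b → H a b ≡ G (f a) (f b)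
  H≡Gf 0F 1F = e01
  H≡Gf 0F 2F = e02
  H≡Gf 0F 3F = e03
  H≡Gf 1F 2F = e12
  H≡Gf 1F 3F = e13
  H≡Gf 2F 3F = e23
  H≡Gf 1F 0F = flip-edge e01
  H≡Gf 2F 0F = flip-edge e02
  H≡Gf 3F 0F = flip-edge e03
  H≡Gf 2F 1F = flip-edge e12
  H≡Gf 3F 1F = flip-edge e13
  H≡Gf 3F 2F = flip-edge e23
  H≡Gf 0F 0F = diagonal 0F
  H≡Gf 1F 1F = diagonal 1F
  H≡Gf 2F 2F = diagonal 2F
  H≡Gf 3F 3F = diagonal 3F

NonadjacencyTransitive : ∀ {n} → Adj n → Set
NonadjacencyTransitive G = ∀ {i j k} → G i j ≡ false → G j k ≡ false → G i k ≡ false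

module _ {n} {G : Adj n} (simple : IsSimple G)
         (no-P₄ : ¬ IsInducedSubgraph P₄ G) (no-paw : ¬ IsInducedSubgraph paw G) where
  open IsSimple simple

  InClosedNeighbourhood : Fin n → Fin n → Fin n → Set
  InClosedNeighbourhood a c x = x ≡ a ⊎ x ≡ c ⊎ G x a ≡ true ⊎ G x c ≡ true

  private
    sym-edge : ∀ {i j b} → G i j ≡ b → b ≡ G j i
    sym-edge {i} {j} e = sym (trans (symmetric j i) e)

  -- With x − k − a − c a path, x outside N[a] ∪ N[c] yields an induced paw or P₄.
  extend-closed-neighbourhood : ∀ {a c k x} → G a c ≡ true → G k a ≡ true → G x k ≡ true →
    InClosedNeighbourhood a c x
  extend-closed-neighbourhood {a} {c} {k} {x} ac ka xk with G x a in xa | G x c in xc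
  ... | true  | _    = inj₂ (inj₂ (inj₁ refl))
  ... | false | true = inj₂ (inj₂ (inj₂ refl))
  ... | false | false with G k c in kc
  ...   | true  = ⊥-elim (no-paw (induced₄ (from-yes (isSimple? paw)) (from-yes (twinFree? paw)) simple
                    (a ∷ c ∷ k ∷ x ∷ []) (sym ac) (sym-edge ka) (sym-edge xa) (sym-edge kc) (sym-edge xc) (sym-edge xk)))
  ...   | false = ⊥-elim (no-P₄ (induced₄ (from-yes (isSimple? P₄)) (from-yes (twinFree? P₄)) simple
                    (x ∷ k ∷ a ∷ c ∷ []) (sym xk) (sym xa) (sym xc) (sym ka) (sym kc) (sym ac)))

  edge-dominates : ∀ {a c} → G a c ≡ true → ∀ {x} → Reach G x a → InClosedNeighbourhood a c x
  edge-dominates ac here = inj₁ refl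
  edge-dominates {a} {c} ac (step xk k⇝a) with edge-dominates ac k⇝a
  ... | inj₁ refl                = inj₂ (inj₂ (inj₁ xk))
  ... | inj₂ (inj₁ refl)         = inj₂ (inj₂ (inj₂ xk))
  ... | inj₂ (inj₂ (inj₁ ka))    = extend-closed-neighbourhood ac ka xk
  ... | inj₂ (inj₂ (inj₂ kc)) with extend-closed-neighbourhood (trans (symmetric c a) ac) kc xk
  ...   | inj₁ x≡c               = inj₂ (inj₁ x≡c)
  ...   | inj₂ (inj₁ x≡a)        = inj₁ x≡a
  ...   | inj₂ (inj₂ (inj₁ xc))  = inj₂ (inj₂ (inj₂ xc))
  ...   | inj₂ (inj₂ (inj₂ xa))  = inj₂ (inj₂ (inj₁ xa))

  nonadjacency-transitive : Connected G → NonadjacencyTransitive G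
  nonadjacency-transitive connected {i} {j} {k} ij kj with G i k in ik
  ... | false = refl
  ... | true with edge-dominates ik (connected j i)
  ...   | inj₁ refl              = trans (sym ik) kj
  ...   | inj₂ (inj₁ refl)       = trans (sym ik) ij
  ...   | inj₂ (inj₂ (inj₁ ji))  = contradiction (trans (sym ij) (trans (symmetric i j) ji)) λ ()
  ...   | inj₂ (inj₂ (inj₂ jk))  = contradiction (trans (sym kj) jk) λ ()

Classifies : ∀ {n k} → (Fin n → Fin k) → (Fin n → Fin n → Set) → Set
Classifies q R = ∀ i j → R i j ⇔ q i ≡ q j

PairwiseUnrelated : ∀ {n k} → (Fin k → Fin n) → (Fin n → Fin n → Set) → Set
PairwiseUnrelated g R = ∀ a b → a ≢ b → ¬ R (g a) (g b)

classes-or-transversal : ∀ n k {R : Fin n → Fin n → Set} → IsDecEquivalence R →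
  (∃ λ q → Classifies {k = k} q R) ⊎ (∃ λ g → PairwiseUnrelated {k = suc k} g R)
classes-or-transversal zero    k eqv = inj₁ ((λ ()) , (λ ()))
classes-or-transversal (suc n) k {R} eqv =
  extend (classes-or-transversal n k (record { isEquivalence = record { refl = R-refl ; sym = R-sym ; trans = R-trans }
                                             ; _≟_ = λ i j → suc i ≟ suc j }))
  where
  open IsDecEquivalence eqv renaming (refl to R-refl; sym to R-sym; trans to R-trans)
  R⁺ : Fin n → Fin n → Set
  R⁺ i j = R (suc i) (suc j)
  new-class : (q : Fin n → Fin k) → Classifies q R⁺ → (c : Fin k) →
    (∀ i → R zero (suc i) ⇔ c ≡ q i) → Classifies (λ { zero → c ; (suc i) → q i }) R
  new-class q cl c to-c zero    zero    = mk⇔ (λ _ → refl) (λ _ → R-refl)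
  new-class q cl c to-c zero    (suc j) = to-c j
  new-class q cl c to-c (suc i) zero    = mk⇔ (λ r → sym (Equivalence.to (to-c i) (R-sym r)))
                                              (λ e → R-sym (Equivalence.from (to-c i) (sym e)))
  new-class q cl c to-c (suc i) (suc j) = cl i j
  extend : (∃ λ q → Classifies q R⁺) ⊎ (∃ λ g → PairwiseUnrelated {k = suc k} g R⁺) →
           (∃ λ q → Classifies q R) ⊎ (∃ λ g → PairwiseUnrelated g R)
  extend (inj₂ (g , unrelated)) = inj₂ (suc ∘ g , unrelated)
  extend (inj₁ (q , cl)) with FP.any? (λ i → zero ≟ suc i)
  ... | yes (i₀ , r₀) =
    inj₁ (_ , new-class q cl (q i₀) (λ i → mk⇔ (λ r → Equivalence.to (cl i₀ i) (R-trans (R-sym r₀) r))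
                                              (λ e → R-trans r₀ (Equivalence.from (cl i₀ i) e))))
  ... | no ¬r₀ with all-or-counterexample (λ c → FP.any? (λ i → q i F.≟ c))
  ...   | inj₂ (c , unused) =
    inj₁ (_ , new-class q cl c (λ i → mk⇔ (λ r → ⊥-elim (¬r₀ (i , r))) (λ e → ⊥-elim (unused (i , sym e)))))
  ...   | inj₁ onto = inj₂ (g , unrelated)
    where
    g : Fin (suc k) → Fin (suc n)
    g zero    = zero
    g (suc c) = suc (proj₁ (onto c))
    unrelated : PairwiseUnrelated g R
    unrelated zero    zero    0≢0 _ = 0≢0 refl
    unrelated zero    (suc c) _   r = ¬r₀ (_ , r)
    unrelated (suc c) zero    _   r = ¬r₀ (_ , R-sym r)
    unrelated (suc c) (suc d) c≢d r =
      c≢d (cong suc (trans (sym (proj₂ (onto c))) (trans (Equivalence.to (cl _ _) r) (proj₂ (onto d)))))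

bool-≡-via-false : ∀ {b c : Bool} → (b ≡ false ⇔ c ≡ false) → b ≡ c
bool-≡-via-false {false} b⇔c = sym (Equivalence.to b⇔c refl)
bool-≡-via-false {true} {false} b⇔c = Equivalence.from b⇔c refl
bool-≡-via-false {true} {true} _ = refl

completeMultipartite-false⇔ : ∀ {N k} (p : Fin N → Fin k) x y → completeMultipartite p x y ≡ false ⇔ p x ≡ p y
completeMultipartite-false⇔ p x y with p x F.≟ p y
... | yes px≡py = mk⇔ (λ _ → px≡py) (λ _ → refl)
... | no px≢py  = mk⇔ (λ ()) (⊥-elim ∘ px≢py)

complete-false⇔ : ∀ {k} (a b : Fin k) → complete k a b ≡ false ⇔ a ≡ b
complete-false⇔ a b with a F.≟ b
... | yes a≡b = mk⇔ (λ _ → a≡b) (λ _ → refl)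
... | no a≢b  = mk⇔ (λ ()) (⊥-elim ∘ a≢b)

completeMultipartite≡complete : ∀ {N k} (p : Fin N → Fin k) x y →
  completeMultipartite p x y ≡ complete k (p x) (p y)
completeMultipartite≡complete p x y =
  bool-≡-via-false (⇔.trans (completeMultipartite-false⇔ p x y) (⇔.sym (complete-false⇔ (p x) (p y))))

BlowupOfK₄ : ∀ {n} → Adj n → (Fin n → Fin 4) → Set
BlowupOfK₄ G q = ∀ i j → G i j ≡ complete 4 (q i) (q j)

complete4partite⇒blowup : ∀ {n} {G : Adj n} → IsInducedSubgraphOfComplete4Partite G → ∃ (BlowupOfK₄ G)
complete4partite⇒blowup (N , p , _ , f , _ , G≡) =
  p ∘ f , λ i j → trans (G≡ i j) (completeMultipartite≡complete p (f i) (f j))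

blowup⇒complete4partite : ∀ {n} {G : Adj n} {q} → BlowupOfK₄ G q → IsInducedSubgraphOfComplete4Partite G
blowup⇒complete4partite {n} {G} {q} G≡ = 4 ℕ.+ n , p , onto , (4 F.↑ʳ_) , FP.↑ʳ-injective 4 _ _ , G≡p
  where
  p : Fin (4 ℕ.+ n) → Fin 4
  p 0F = 0F
  p 1F = 1F
  p 2F = 2F
  p 3F = 3F
  p (suc (suc (suc (suc i)))) = q i
  onto : Surjective _≡_ _≡_ p
  onto 0F = 0F , λ { refl → refl }
  onto 1F = 1F , λ { refl → refl }
  onto 2F = 2F , λ { refl → refl }
  onto 3F = 3F , λ { refl → refl }
  G≡p : ∀ i j → G i j ≡ completeMultipartite p (4 F.↑ʳ i) (4 F.↑ʳ j)
  G≡p i j = trans (G≡ i j) (sym (completeMultipartite≡complete p (4 F.↑ʳ i) (4 F.↑ʳ j)))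

blowup-nonadjacency-transitive : ∀ {n} {G : Adj n} {q} → BlowupOfK₄ G q → NonadjacencyTransitive G
blowup-nonadjacency-transitive {G = G} {q} G≡ {i} {j} {k} ij jk =
  trans (G≡ i k) (Equivalence.from (complete-false⇔ (q i) (q k)) (trans (same-part ij) (same-part jk)))
  where
  same-part : ∀ {x y} → G x y ≡ false → q x ≡ q y
  same-part {x} {y} xy = Equivalence.to (complete-false⇔ (q x) (q y)) (trans (sym (G≡ x y)) xy)

-- P₄ and the paw contain an induced K₁ + K₂: a ≁ b ≁ c with a ∼ c.
¬induced-with-nonadjacent-pair : ∀ {k n} {H : Adj k} {G : Adj n} → NonadjacencyTransitive G →
  (a b c : Fin k) → H a b ≡ false → H b c ≡ false → H a c ≡ true → ¬ IsInducedSubgraph H G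
¬induced-with-nonadjacent-pair trans-G a b c ab bc ac (f , _ , H≡Gf) =
  contradiction (trans (sym ac) (trans (H≡Gf a c) (trans-G {f a} {f b} {f c} (trans (sym (H≡Gf a b)) ab) (trans (sym (H≡Gf b c)) bc)))) λ ()

blowup⇒P₄-paw-K₅-free : ∀ {n} {G : Adj n} {q} → BlowupOfK₄ G q → P₄-paw-K₅-free G
blowup⇒P₄-paw-K₅-free {G = G} {q} G≡ =
  ¬induced-with-nonadjacent-pair {H = P₄} {G} (blowup-nonadjacency-transitive G≡) 2F 0F 3F refl refl refl ,
  ¬induced-with-nonadjacent-pair {H = paw} {G} (blowup-nonadjacency-transitive G≡) 0F 3F 1F refl refl refl ,
  no-K₅
  where
  no-K₅ : ¬ IsInducedSubgraph K₅ G
  no-K₅ (f , _ , K₅≡Gf) with FP.pigeonhole (ℕP.n<1+n 4) (q ∘ f)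
  ... | a , b , a<b , same-part = FP.<⇒≢ a<b (Equivalence.to (complete-false⇔ a b)
          (trans (K₅≡Gf a b) (trans (G≡ (f a) (f b)) (Equivalence.from (complete-false⇔ _ _) same-part))))

P₄-paw-K₅-free⇒blowup : ∀ {n} {G : Adj n} → IsSimple G → Connected G → P₄-paw-K₅-free G → ∃ (BlowupOfK₄ G)
P₄-paw-K₅-free⇒blowup {n} {G} simple connected (no-P₄ , no-paw , no-K₅)
  with classes-or-transversal n 4 nonadjacency-isDecEquivalence
  where
  open IsSimple simple
  nonadjacency-isDecEquivalence : IsDecEquivalence (λ i j → G i j ≡ false)
  nonadjacency-isDecEquivalence = record
    { isEquivalence = record
      { refl  = loopless _
      ; sym   = λ {i} {j} ij → trans (symmetric j i) ij
      ; trans = nonadjacency-transitive simple no-P₄ no-paw connected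
      }
    ; _≟_ = λ i j → G i j BoolP.≟ false
    }
... | inj₁ (q , classifies) =
  q , λ i j → bool-≡-via-false (⇔.trans (classifies i j) (⇔.sym (complete-false⇔ (q i) (q j))))
... | inj₂ (g , unrelated) = ⊥-elim (no-K₅ (embedding-of-twinFree {H = K₅} {G} (from-yes (twinFree? K₅)) g K₅≡Gg))
  where
  same⇔nonadjacent : ∀ a b → a ≡ b ⇔ G (g a) (g b) ≡ false
  same⇔nonadjacent a b = mk⇔ (λ { refl → IsSimple.loopless simple (g a) })
                             (λ nonadjacent → Dec.decidable-stable (a F.≟ b) (λ a≢b → unrelated a b a≢b nonadjacent))
  K₅≡Gg : ∀ a b → K₅ a b ≡ G (g a) (g b)
  K₅≡Gg a b = bool-≡-via-false (⇔.trans (complete-false⇔ a b) (same⇔nonadjacent a b))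

-- Invariant factors

∼-sym : ∀ {n} {A B : Mat n} → A ∼ B → B ∼ A
∼-sym {A = A} {B} (equivalent P Q (P⁻¹ , PP⁻¹ , P⁻¹P) (Q⁻¹ , QQ⁻¹ , Q⁻¹Q) PAQ≈B) =
  equivalent P⁻¹ Q⁻¹ (P , P⁻¹P , PP⁻¹) (Q , Q⁻¹Q , QQ⁻¹) chain
  where
  open MatReasoning
  chain : ((P⁻¹ ⊗ B) ⊗ Q⁻¹) ≈M A
  chain = begin
    (P⁻¹ ⊗ B) ⊗ Q⁻¹                 ≈⟨ ·-congˡ Q⁻¹ (·-congʳ P⁻¹ (≈M-sym PAQ≈B)) ⟩
    (P⁻¹ ⊗ ((P ⊗ A) ⊗ Q)) ⊗ Q⁻¹     ≈⟨ ·-congˡ Q⁻¹ (≈M-sym (·-assoc P⁻¹ (P ⊗ A) Q)) ⟩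
    ((P⁻¹ ⊗ (P ⊗ A)) ⊗ Q) ⊗ Q⁻¹     ≈⟨ ·-assoc (P⁻¹ ⊗ (P ⊗ A)) Q Q⁻¹ ⟩
    (P⁻¹ ⊗ (P ⊗ A)) ⊗ (Q ⊗ Q⁻¹)     ≈⟨ ·-congʳ (P⁻¹ ⊗ (P ⊗ A)) QQ⁻¹ ⟩
    (P⁻¹ ⊗ (P ⊗ A)) ⊗ idMat         ≈⟨ ·-identityʳ (P⁻¹ ⊗ (P ⊗ A)) ⟩
    P⁻¹ ⊗ (P ⊗ A)                   ≈⟨ ≈M-sym (·-assoc P⁻¹ P A) ⟩
    (P⁻¹ ⊗ P) ⊗ A                   ≈⟨ ·-congˡ A P⁻¹P ⟩
    idMat ⊗ A                       ≈⟨ ·-identityˡ A ⟩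
    A                               ∎

dropCorner : ∀ {n} → Mat (suc n) → Mat n
dropCorner D i j = D (suc i) (suc j)

countOnes-≤ : ∀ {n} (D : Mat n) → countOnes D ≤ n
countOnes-≤ {zero}  D = z≤n
countOnes-≤ {suc n} D with D 0F 0F ℤ.≟ 1ℤ
... | yes _ = s≤s (countOnes-≤ (dropCorner D))
... | no _  = ℕP.m≤n⇒m≤1+n (countOnes-≤ (dropCorner D))

countOnes-one : ∀ {n} (D : Mat (suc n)) → D 0F 0F ≡ 1ℤ → countOnes D ≡ suc (countOnes (dropCorner D))
countOnes-one D d≡1 with D 0F 0F ℤ.≟ 1ℤ
... | yes _  = refl
... | no d≢1 = ⊥-elim (d≢1 d≡1)

countOnes-step : ∀ {n} (D : Mat (suc n)) → countOnes D ≤ suc (countOnes (dropCorner D))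
countOnes-step D with D 0F 0F ℤ.≟ 1ℤ
... | yes _ = ℕP.≤-refl
... | no _  = ℕP.n≤1+n _

countOnes-none : ∀ {n} (D : Mat n) → (∀ i → D i i ≢ 1ℤ) → countOnes D ≡ 0
countOnes-none {zero}  D _ = refl
countOnes-none {suc n} D d≢1 with D 0F 0F ℤ.≟ 1ℤ
... | yes d≡1 = ⊥-elim (d≢1 0F d≡1)
... | no _    = countOnes-none (dropCorner D) (d≢1 ∘ suc)

nonneg∣1⇒≡1 : ∀ {x} → 0ℤ ℤ.≤ x → x ℤD.∣ 1ℤ → x ≡ 1ℤ
nonneg∣1⇒≡1 {+ k} _ k∣1 = cong +_ (ℕD.∣1⇒≡1 k∣1)

module _ {r : ℕ} {D : Mat (4 ℕ.+ r)} (smith : IsSmithForm D) where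
  private
    nonneg : ∀ i → 0ℤ ℤ.≤ D i i
    nonneg = proj₁ (proj₂ smith)
    divides-later : ∀ i j → toℕ i ≤ toℕ j → D i i ℤD.∣ D j j
    divides-later = proj₂ (proj₂ smith)

  smith-leading-ones : D 3F 3F ≡ 1ℤ → ∀ a → D (a F.↑ˡ r) (a F.↑ˡ r) ≡ 1ℤ
  smith-leading-ones d₄≡1 a = nonneg∣1⇒≡1 (nonneg (a F.↑ˡ r))
    (subst (λ d → D (a F.↑ˡ r) (a F.↑ˡ r) ℤD.∣ d) d₄≡1
      (divides-later (a F.↑ˡ r) 3F (subst (ℕ._≤ 3) (sym (FP.toℕ-↑ˡ a r)) (FP.toℕ≤pred[n] a))))

  smith-leading-identity : D 3F 3F ≡ 1ℤ → ∀ a b → D (a F.↑ˡ r) (b F.↑ˡ r) ≡ idMat a b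
  smith-leading-identity d₄≡1 a b with a F.≟ b
  ... | yes refl = smith-leading-ones d₄≡1 a
  ... | no a≢b   = proj₁ smith _ _ (a≢b ∘ FP.↑ˡ-injective r a b)

  private
    D₁ : Mat (3 ℕ.+ r)
    D₁ = dropCorner D
    D₂ : Mat (2 ℕ.+ r)
    D₂ = dropCorner D₁
    D₃ : Mat (1 ℕ.+ r)
    D₃ = dropCorner D₂

  4≤countOnes : D 3F 3F ≡ 1ℤ → 4 ≤ countOnes D
  4≤countOnes d₄≡1 = begin
    4                                     ≤⟨ ℕP.m≤m+n 4 _ ⟩
    4 ℕ.+ countOnes (dropCorner D₃)       ≡⟨ cong (3 ℕ.+_) (countOnes-one D₃ d₄≡1) ⟨
    3 ℕ.+ countOnes D₃                    ≡⟨ cong (2 ℕ.+_) (countOnes-one D₂ (one 2F)) ⟨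
    2 ℕ.+ countOnes D₂                    ≡⟨ cong suc (countOnes-one D₁ (one 1F)) ⟨
    1 ℕ.+ countOnes D₁                    ≡⟨ countOnes-one D (one 0F) ⟨
    countOnes D                           ∎
    where
    open ℕP.≤-Reasoning
    one : ∀ a → D (a F.↑ˡ r) (a F.↑ˡ r) ≡ 1ℤ
    one = smith-leading-ones d₄≡1

  countOnes≤3 : D 3F 3F ≢ 1ℤ → countOnes D ≤ 3
  countOnes≤3 d₄≢1 = begin
    countOnes D              ≤⟨ countOnes-step D ⟩
    1 ℕ.+ countOnes D₁       ≤⟨ s≤s (countOnes-step D₁) ⟩
    2 ℕ.+ countOnes D₂       ≤⟨ s≤s (s≤s (countOnes-step D₂)) ⟩
    3 ℕ.+ countOnes D₃       ≡⟨ cong (3 ℕ.+_) (countOnes-none D₃ later≢1) ⟩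
    3                        ∎
    where
    open ℕP.≤-Reasoning
    later≢1 : ∀ i → D₃ i i ≢ 1ℤ
    later≢1 i dᵢ≡1 = d₄≢1 (nonneg∣1⇒≡1 (nonneg 3F)
      (subst (D 3F 3F ℤD.∣_) dᵢ≡1 (divides-later 3F (suc (suc (suc i))) (s≤s (s≤s (s≤s z≤n))))))

-- A = L D R with D diagonal, and modulo d₄ only the first three diagonal entries survive.
smith-rank≤3-mod : ∀ {r} {A D : Mat (4 ℕ.+ r)} → IsSmithForm D → A ∼ D →
  Σ (Matrix (4 ℕ.+ r) 3) λ U → Σ (Matrix 3 (4 ℕ.+ r)) λ V → ∀ i j → A i j ≡ (U · V) i j mod D 3F 3F
smith-rank≤3-mod {r} {A} {D} (diagonal , _ , divides-later) A∼D = U , V , A≡UV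
  where
  open _∼_ (∼-sym A∼D) renaming (P to L; Q to R; PAQ≈B to LDR≈A)
  d₄ : ℤ
  d₄ = D 3F 3F
  ι : Fin 3 → Fin (4 ℕ.+ r)
  ι c = c F.↑ˡ suc r
  U : Matrix (4 ℕ.+ r) 3
  U l c = L l (ι c) * D (ι c) (ι c)
  V : Matrix 3 (4 ℕ.+ r)
  V c k = R (ι c) k
  LD-diagonal : ∀ l x → (L ⊗ D) l x ≡ L l x * D x x
  LD-diagonal l x = sum-supportedAt x (λ y → L l y * D y x)
    (λ y y≢x → trans (cong (L l y *_) (diagonal y x y≢x)) (ℤP.*-zeroʳ (L l y)))
  term : Fin (4 ℕ.+ r) → Fin (4 ℕ.+ r) → Fin (4 ℕ.+ r) → ℤ
  term l k x = L l x * D x x * R x k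
  later-terms≡0 : ∀ l k → sumFin (λ x → term l k (suc (suc (suc x)))) ≡ 0ℤ mod d₄
  later-terms≡0 l k = ≡mod-trans (sum-cong-mod {f = λ x → term l k (suc (suc (suc x)))} term≡0)
                                 (≡mod-reflexive (sum-zero {suc r} (λ _ → refl)))
    where
    term≡0 : ∀ x → term l k (suc (suc (suc x))) ≡ 0ℤ mod d₄
    term≡0 x = Equivalence.from ≡mod-0⇔∣
      (∣m⇒∣m*n (R _ k) (∣n⇒∣m*n (L l _) (∣ᵤ⇒∣ (divides-later 3F (suc (suc (suc x))) (s≤s (s≤s (s≤s z≤n)))))))
  A≡UV : ∀ l k → A l k ≡ (U · V) l k mod d₄
  A≡UV l k = begin
    A l k                          ≡⟨ LDR≈A l k ⟨
    ((L ⊗ D) ⊗ R) l k              ≡⟨ sum-cong (λ x → cong (_* R x k) (LD-diagonal l x)) ⟩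
    sumFin (term l k)              ≈⟨ ≡mod-+ (≡mod-refl (term l k 0F)) (≡mod-+ (≡mod-refl (term l k 1F))
                                        (≡mod-+ (≡mod-refl (term l k 2F)) (later-terms≡0 l k))) ⟩
    (U · V) l k                    ∎
    where open ModReasoning d₄

matrix : ∀ {m n} → Vec (Vec ℤ n) m → Matrix m n
matrix rows i j = lookup (lookup rows i) j

≈M? : ∀ {n} (A B : Mat n) → Dec (A ≈M B)
≈M? A B = FP.all? λ i → FP.all? λ j → A i j ℤ.≟ B i j

adjSubmatrix : ∀ {k} → Adj k → Vec (Fin k) 4 → Vec (Fin k) 4 → Matrix 4 4
adjSubmatrix H rows cols x y = adjMat H (lookup rows x) (lookup cols y)

record UnimodularMinor₄ {k} (H : Adj k) : Set where
  field
    rows cols    : Vec (Fin k) 4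
    inverse      : Matrix 4 4
    inverse-left : (inverse ⊗ adjSubmatrix H rows cols) ≈M idMat

P₄-minor : UnimodularMinor₄ P₄
P₄-minor = record
  { rows = rs ; cols = cs
  ; inverse = N
  ; inverse-left = from-yes (≈M? (N ⊗ adjSubmatrix P₄ rs cs) idMat)
  }
  where
  rs cs : Vec (Fin 4) 4
  rs = 0F ∷ 1F ∷ 2F ∷ 3F ∷ []
  cs = 0F ∷ 1F ∷ 2F ∷ 3F ∷ []
  N : Matrix 4 4
  N = matrix (( 0ℤ ∷ 1ℤ ∷ 0ℤ ∷ -1ℤ ∷ [])
      ∷ ( 1ℤ ∷ 0ℤ ∷ 0ℤ ∷ 0ℤ ∷ [])
      ∷ ( 0ℤ ∷ 0ℤ ∷ 0ℤ ∷ 1ℤ ∷ [])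
      ∷ (-1ℤ ∷ 0ℤ ∷ 1ℤ ∷ 0ℤ ∷ []) ∷ [])

paw-minor : UnimodularMinor₄ paw
paw-minor = record
  { rows = rs ; cols = cs
  ; inverse = N
  ; inverse-left = from-yes (≈M? (N ⊗ adjSubmatrix paw rs cs) idMat)
  }
  where
  rs cs : Vec (Fin 4) 4
  rs = 0F ∷ 1F ∷ 2F ∷ 3F ∷ []
  cs = 0F ∷ 1F ∷ 2F ∷ 3F ∷ []
  N : Matrix 4 4
  N = matrix (( 0ℤ ∷  1ℤ ∷ 0ℤ ∷ -1ℤ ∷ [])
      ∷ ( 1ℤ ∷  0ℤ ∷ 0ℤ ∷ -1ℤ ∷ [])
      ∷ ( 0ℤ ∷  0ℤ ∷ 0ℤ ∷  1ℤ ∷ [])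
      ∷ (-1ℤ ∷ -1ℤ ∷ 1ℤ ∷ + 2 ∷ []) ∷ [])

K₅-minor : UnimodularMinor₄ K₅
K₅-minor = record
  { rows = rs ; cols = cs
  ; inverse = N
  ; inverse-left = from-yes (≈M? (N ⊗ adjSubmatrix K₅ rs cs) idMat)
  }
  where
  rs cs : Vec (Fin 5) 4
  rs = 0F ∷ 1F ∷ 2F ∷ 3F ∷ []
  cs = 0F ∷ 1F ∷ 2F ∷ 4F ∷ []
  N : Matrix 4 4
  N = matrix ((-1ℤ ∷  0ℤ ∷  0ℤ ∷  1ℤ ∷ [])
      ∷ ( 0ℤ ∷ -1ℤ ∷  0ℤ ∷  1ℤ ∷ [])
      ∷ ( 0ℤ ∷  0ℤ ∷ -1ℤ ∷  1ℤ ∷ [])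
      ∷ ( 1ℤ ∷  1ℤ ∷  1ℤ ∷ - (+ 2) ∷ []) ∷ [])

induced-minor⇒∣1 : ∀ {k n m} {H : Adj k} {G : Adj n} → IsInducedSubgraph H G → UnimodularMinor₄ H →
  (U : Matrix n 3) (V : Matrix 3 n) → (∀ i j → adjMat G i j ≡ (U · V) i j mod m) → m ∣ 1ℤ
induced-minor⇒∣1 {k} {H = H} {G} (f , _ , H≡Gf) minor U V A≡UV =
  factors-through-3-mod⇒∣1 (λ x → U (f (row x))) (λ c y → V c (f (col y))) (λ x y → A≡UV _ _)
    inverse idMat N·M·I≈I
  where
  open UnimodularMinor₄ minor
  row col : Fin 4 → Fin k
  row = lookup rows
  col = lookup cols
  M : Matrix 4 4
  M x y = adjMat G (f (row x)) (f (col y))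
  N·M·I≈I : ∀ a b → ((inverse · M) · idMat) a b ≡ idMat a b
  N·M·I≈I a b = trans (·-identityʳ (inverse · M) a b)
    (trans (·-congʳ inverse (λ x y → cong (if_then 1ℤ else 0ℤ) (sym (H≡Gf (row x) (col y)))) a b)
           (inverse-left a b))

K₄-left-factor : Matrix 4 3
K₄-left-factor = matrix (( 1ℤ ∷  0ℤ ∷  0ℤ ∷ [])
                       ∷ ( 0ℤ ∷  1ℤ ∷  0ℤ ∷ [])
                       ∷ ( 0ℤ ∷  0ℤ ∷  1ℤ ∷ [])
                       ∷ (-1ℤ ∷ -1ℤ ∷ -1ℤ ∷ []) ∷ [])

K₄-right-factor : Matrix 3 4
K₄-right-factor = matrix ((0ℤ ∷ 1ℤ ∷ 1ℤ ∷ 1ℤ ∷ [])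
                        ∷ (1ℤ ∷ 0ℤ ∷ 1ℤ ∷ 1ℤ ∷ [])
                        ∷ (1ℤ ∷ 1ℤ ∷ 0ℤ ∷ 1ℤ ∷ []) ∷ [])

-- (J − I) 𝟙 = 3 𝟙, so modulo 3 the matrix J − I of K₄ is singular and factors through rank 3.
K₄-factorisation-mod-3 : ∀ a b → adjMat (complete 4) a b ≡ (K₄-left-factor · K₄-right-factor) a b mod + 3
K₄-factorisation-mod-3 = from-yes (FP.all? λ a → FP.all? λ b →
  adjMat (complete 4) a b ≡? (K₄-left-factor · K₄-right-factor) a b mod + 3)

AtMost3Ones : ∀ {n} → Adj n → Set
AtMost3Ones G = ∀ D → IsSNFOf D (adjMat G) → countOnes D ≤ 3

data SizeView : ℕ → Set where
  small : ∀ {n} → n ℕ.< 4 → SizeView n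
  large : ∀ r → SizeView (4 ℕ.+ r)

sizeView : ∀ n → SizeView n
sizeView 0 = small (s≤s z≤n)
sizeView 1 = small (s≤s (s≤s z≤n))
sizeView 2 = small (s≤s (s≤s (s≤s z≤n)))
sizeView 3 = small ℕP.≤-refl
sizeView (suc (suc (suc (suc r)))) = large r

blowup⇒at-most-3-ones : ∀ n {G : Adj n} {q} → BlowupOfK₄ G q → AtMost3Ones G
blowup⇒at-most-3-ones n {G} {q} G≡ D snf with sizeView n
... | small n<4 = ℕP.≤-trans (countOnes-≤ D) (ℕP.≤-pred n<4)
... | large r with Equivalence.to (IsSNFOf⇔ {A = adjMat G}) snf | D 3F 3F ℤ.≟ 1ℤ
...   | smith , _   | no d₄≢1 = countOnes≤3 smith d₄≢1
...   | smith , A∼D | yes d₄≡1 = contradiction (factors-through-3-mod⇒∣1 U V A≡UV L R LAR≡I) 3∤1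
  where
  open _∼_ A∼D
  U : Matrix (4 ℕ.+ r) 3
  U l c = K₄-left-factor (q l) c
  V : Matrix 3 (4 ℕ.+ r)
  V c k = K₄-right-factor c (q k)
  A≡UV : ∀ l k → adjMat G l k ≡ (U · V) l k mod + 3
  A≡UV l k = ≡mod-trans (≡mod-reflexive (cong (if_then 1ℤ else 0ℤ) (G≡ l k))) (K₄-factorisation-mod-3 (q l) (q k))
  L : Matrix 4 (4 ℕ.+ r)
  L a l = P (a F.↑ˡ r) l
  R : Matrix (4 ℕ.+ r) 4
  R k b = Q k (b F.↑ˡ r)
  LAR≡I : ∀ a b → ((L · adjMat G) · R) a b ≡ idMat a b
  LAR≡I a b = trans (PAQ≈B (a F.↑ˡ r) (b F.↑ˡ r)) (smith-leading-identity smith d₄≡1 a b)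
  3∤1 : ¬ (+ 3 ∣ 1ℤ)
  3∤1 3∣1 with ℕD.∣1⇒≡1 (∣⇒∣ᵤ 3∣1)
  ... | ()

at-most-3-ones⇒P₄-paw-K₅-free : ∀ n (G : Adj n) → AtMost3Ones G → P₄-paw-K₅-free G
at-most-3-ones⇒P₄-paw-K₅-free n G at-most-3 with sizeView n
... | small n<4 = P₄-paw-K₅-free-small G n<4
... | large r = excluded P₄-minor , excluded paw-minor , excluded K₅-minor
  where
  snf : ∃ λ D → IsSmithForm D × adjMat G ∼ D
  snf = smith-normal-form _ (adjMat G)
  D : Mat n
  D = proj₁ snf
  smith : IsSmithForm D
  smith = proj₁ (proj₂ snf)
  A∼D : adjMat G ∼ D
  A∼D = proj₂ (proj₂ snf)
  d₄≢1 : D 3F 3F ≢ 1ℤ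
  d₄≢1 d₄≡1 = ℕP.<⇒≱ (s≤s (at-most-3 D (Equivalence.from IsSNFOf⇔ (smith , A∼D)))) (4≤countOnes smith d₄≡1)
  rank≤3 : Σ (Matrix n 3) λ U → Σ (Matrix 3 n) λ V → ∀ i j → adjMat G i j ≡ (U · V) i j mod D 3F 3F
  rank≤3 = smith-rank≤3-mod smith A∼D
  excluded : ∀ {k} {H : Adj k} → UnimodularMinor₄ H → ¬ IsInducedSubgraph H G
  excluded minor H↪G = d₄≢1 (nonneg∣1⇒≡1 (proj₁ (proj₂ smith) 3F)
    (∣⇒∣ᵤ (induced-minor⇒∣1 H↪G minor (proj₁ rank≤3) (proj₁ (proj₂ rank≤3)) (proj₂ (proj₂ rank≤3)))))

mainTheorem7 : (n : ℕ) (G : Adj n) → IsSimple G → Connected G →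
    ((∀ D → IsSNFOf D (adjMat G) → countOnes D ≤ 3)
      ⇔ (¬ IsInducedSubgraph P₄ G × ¬ IsInducedSubgraph paw G × ¬ IsInducedSubgraph K₅ G))
    × ((¬ IsInducedSubgraph P₄ G × ¬ IsInducedSubgraph paw G × ¬ IsInducedSubgraph K₅ G)
      ⇔ IsInducedSubgraphOfComplete4Partite G)
mainTheorem7 n G simple connected =
  mk⇔ (at-most-3-ones⇒P₄-paw-K₅-free n G) (blowup⇒at-most-3-ones n ∘ proj₂ ∘ blowup-of-free) ,
  mk⇔ (blowup⇒complete4partite ∘ proj₂ ∘ blowup-of-free) (blowup⇒P₄-paw-K₅-free ∘ proj₂ ∘ complete4partite⇒blowup)
  where
  blowup-of-free : P₄-paw-K₅-free G → ∃ (BlowupOfK₄ G)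
  blowup-of-free = P₄-paw-K₅-free⇒blowup simple connected
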